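{- Let $\lambda=w_1\cdots w_l$ be a word in $N,E$, with $c([r,s])$ and the sequences $\rho,\kappa$ as in the context. Let $1\le a,b\le l-2$ be such that $\rho_{a'}\le\kappa_{b'}$ for all $a'\in\{a,a+1,a+2\}$ and $b'\in\{b,b+1,b+2\}$. Then \[ \det\begin{bmatrix} c([\rho_{a+2},\kappa_b]) & c([\rho_{a+2},\kappa_{b+1}]) & c([\rho_{a+2},\kappa_{b+2}])\\ c([\rho_{a+1},\kappa_b]) & c([\rho_{a+1},\kappa_{b+1}]) & c([\rho_{a+1},\kappa_{b+2}])\\ c([\rho_{a},\kappa_b]) & c([\rho_{a},\kappa_{b+1}]) & c([\rho_{a},\kappa_{b+2}]) \end{bmatrix}=0. \]
   Context: Lattice points: $P_1=(1,1)$ and $P_{k+1}=P_k+(0,1)$ if $w_k=N$, $P_{k+1}=P_k+(1,0)$ if $w_k=E$. The $a_{ij}$ are independent indeterminates; for $P=(x,y)$, $B(P)$ is the $2\times2$ matrix with top row $(a_{x,y+1},a_{x+1,y+1})$ and bottom row $(a_{x,y},a_{x+1,y})$. For a block $B$, $h_\pm(B)$ are its top/bottom rows and $v_-(B),v_+(B)$ its left/right columns. DRH matrix $X_0X_1\cdots X_n$ of dominoes ($1\times2$ horizontal or $2\times1$ vertical matrices) and $2\times2$ blocks: place pieces successively, each directly above (left edges aligned) or directly right of (bottom edges aligned) the previous, directions alternating and starting with "above" if $X_0$ is horizontal and "right" if $X_0$ is vertical; fill other cells of the bounding rectangle with $0$ and read rows top to bottom, columns left to right. For $1\le r\le s\le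 l$, with bends $k_1<\dots<k_m$ of $[r,s]$ (indices $r<k\le s$ with $w_{k-1}\neq w_k$), $\mathrm{Std}([r,s])=X_0B(P_{k_1})\cdots B(P_{k_m})X_{m+1}$ where $X_0=h_-(B(P_r))$ if $w_r=N$, $v_-(B(P_r))$ if $w_r=E$, and $X_{m+1}=h_+(B(P_{s+1}))$ if $w_s=N$, $v_+(B(P_{s+1}))$ if $w_s=E$; it is $\eta\times\eta$ and $c([r,s])=(-1)^{(\eta-1)(\eta-2)/2}\det\mathrm{Std}([r,s])$. With $e_1<\dots<e_\varepsilon$ the $E$-indices and $n_1<\dots<n_\nu$ the $N$-indices of $\lambda$, $\rho=(e_\varepsilon,\dots,e_1,n_1,\dots,n_\nu)$ and $\kappa=(e_1,\dots,e_\varepsilon,n_\nu,\dots,n_1)$. -}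

module Defs where

open import Data.Nat using (ℕ; zero; suc; _+_; _*_; _∸_; _<ᵇ_; _≤ᵇ_; _⊔_)
open import Data.Nat.DivMod using (_/_)
open import Data.Bool using (Bool; true; false; if_then_else_; _∧_; not)
open import Data.List using (List; []; _∷_; _++_; reverse; length)
open import Data.Product using (_×_; _,_)
open import Algebra.Bundles using (CommutativeRing)

data Dir : Set where
  N E : Dir

_==ᴰ_ : Dir → Dir → Bool
N ==ᴰ N = true
E ==ᴰ E = true
_ ==ᴰ _ = false

-- w_k for 1 ≤ k ≤ length w (value outside this range is irrelevant)
wAt : List Dir → ℕ → Dir
wAt [] _ = N
wAt (d ∷ ds) zero = N
wAt (d ∷ ds) (suc zero) = d
wAt (d ∷ ds) (suc (suc k)) = wAt ds (suc k)

step : Dir → ℕ × ℕ → ℕ × ℕ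
step N (x , y) = (x , suc y)
step E (x , y) = (suc x , y)

P : List Dir → ℕ → ℕ × ℕ
P w zero = (1 , 1)
P w (suc zero) = (1 , 1)
P w (suc (suc k)) = step (wAt w (suc k)) (P w (suc k))

ivl : ℕ → ℕ → List ℕ
ivl r zero = []
ivl r (suc n) = r ∷ ivl (suc r) n

interval : ℕ → ℕ → List ℕ
interval r s = ivl r (suc s ∸ r)

filt : (ℕ → Bool) → List ℕ → List ℕ
filt p [] = []
filt p (k ∷ ks) = if p k then k ∷ filt p ks else filt p ks

bends : List Dir → ℕ → ℕ → List ℕ
bends w r s = filt (λ k → not (wAt w (k ∸ 1) ==ᴰ wAt w k)) (interval (suc r) s)

eIdx nIdx : List Dir → List ℕ
eIdx w = filt (λ k → wAt w k ==ᴰ E) (interval 1 (length w))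
nIdx w = filt (λ k → wAt w k ==ᴰ N) (interval 1 (length w))

ρ κ : List Dir → List ℕ
ρ w = reverse (eIdx w) ++ nIdx w
κ w = eIdx w ++ reverse (nIdx w)

-- 1-based access into a list (value outside the range is irrelevant)
nth : List ℕ → ℕ → ℕ
nth [] _ = 0
nth (x ∷ xs) zero = 0
nth (x ∷ xs) (suc zero) = x
nth (x ∷ xs) (suc (suc k)) = nth xs (suc k)

-- Everything over a commutative ring R; the indeterminates a_{ij} are
-- modelled by an arbitrary assignment  a : ℕ → ℕ → Carrier.

module WithRing {c ℓ} (R : CommutativeRing c ℓ) where
  open CommutativeRing R using (Carrier; 0#; 1#) renaming (_+_ to _⊕_; _*_ to _⊛_; -_ to ⊖_)

  negPow : ℕ → Carrier
  negPow zero = 1#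
  negPow (suc n) = ⊖ negPow n

  sumTo : ℕ → (ℕ → Carrier) → Carrier
  sumTo zero f = 0#
  sumTo (suc n) f = sumTo n f ⊕ f n

  -- n×n matrices as ℕ → ℕ → Carrier (row, column; 0-based, rows from top)
  minor : ℕ → (ℕ → ℕ → Carrier) → ℕ → ℕ → Carrier
  minor j M i k = M (suc i) (if k <ᵇ j then k else suc k)

  det : ℕ → (ℕ → ℕ → Carrier) → Carrier
  det zero M = 1#
  det (suc n) M = sumTo (suc n) (λ j → negPow j ⊛ (M 0 j ⊛ det n (minor j M)))

  -- a piece (domino or 2×2 block): rows × cols matrix, entries (row from top, col)
  record Piece : Set c where
    constructor piece
    field
      rows cols : ℕ
      ent : ℕ → ℕ → Carrier
  open Piece public

  blockEnt : (ℕ → ℕ → Carrier) → ℕ × ℕ → ℕ → ℕ → Carrier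
  blockEnt a (x , y) zero zero = a x (suc y)
  blockEnt a (x , y) zero (suc zero) = a (suc x) (suc y)
  blockEnt a (x , y) (suc zero) zero = a x y
  blockEnt a (x , y) (suc zero) (suc zero) = a (suc x) y
  blockEnt a (x , y) _ _ = 0#

  -- B(P): top row (a_{x,y+1}, a_{x+1,y+1}), bottom row (a_{x,y}, a_{x+1,y})
  B : (ℕ → ℕ → Carrier) → ℕ × ℕ → Piece
  B a p = piece 2 2 (blockEnt a p)

  h₋ h₊ v₋ v₊ : Piece → Piece
  h₋ X = piece 1 2 (λ i j → ent X 1 j)
  h₊ X = piece 1 2 (λ i j → ent X 0 j)
  v₋ X = piece 2 1 (λ i j → ent X i 0)
  v₊ X = piece 2 1 (λ i j → ent X i 1)

  -- placed piece: (bottom coordinate from the bottom, left coordinate, piece)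
  Placed : Set c
  Placed = ℕ × ℕ × Piece

  -- DRH layout: first piece at (0,0); `above` says how the NEXT piece is
  -- placed relative to the current one (directly above, left edges aligned,
  -- or directly right, bottom edges aligned); directions alternate.
  layout : Bool → ℕ → ℕ → List Piece → List Placed
  layout above by bx [] = []
  layout above by bx (X ∷ Xs) =
    (by , bx , X) ∷ layout (not above) (if above then by + rows X else by)
                                       (if above then bx else bx + cols X) Xs

  heightOf widthOf : List Placed → ℕ
  heightOf [] = 0
  heightOf ((by , bx , X) ∷ ps) = (by + rows X) ⊔ heightOf ps
  widthOf [] = 0
  widthOf ((by , bx , X) ∷ ps) = (bx + cols X) ⊔ widthOf ps

  -- entry at global cell (Y from bottom, column j); 0 outside all pieces
  cellAt : List Placed → ℕ → ℕ → Carrier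
  cellAt [] Y j = 0#
  cellAt ((by , bx , X) ∷ ps) Y j =
    if (by ≤ᵇ Y) ∧ (Y <ᵇ by + rows X) ∧ (bx ≤ᵇ j) ∧ (j <ᵇ bx + cols X)
    then ent X (rows X ∸ suc (Y ∸ by)) (j ∸ bx)
    else cellAt ps Y j

  -- the DRH matrix X_0 X_1 ⋯ X_n; starts with "above" iff X_0 is horizontal
  -- (rows X_0 = 1).  Returns the number of rows and the entries read
  -- top-to-bottom, left-to-right.
  drhRows : List Piece → ℕ
  drhRows [] = 0
  drhRows (X ∷ Xs) = heightOf (layout (rows X ≤ᵇ 1) 0 0 (X ∷ Xs))

  drhCols : List Piece → ℕ
  drhCols [] = 0
  drhCols (X ∷ Xs) = widthOf (layout (rows X ≤ᵇ 1) 0 0 (X ∷ Xs))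

  drhMat : List Piece → ℕ → ℕ → Carrier
  drhMat [] i j = 0#
  drhMat (X ∷ Xs) i j =
    let ps = layout (rows X ≤ᵇ 1) 0 0 (X ∷ Xs) in cellAt ps (heightOf ps ∸ suc i) j

  mapB : (ℕ → ℕ → Carrier) → List Dir → List ℕ → List Piece
  mapB a w [] = []
  mapB a w (k ∷ ks) = B a (P w k) ∷ mapB a w ks

  stdPieces : (ℕ → ℕ → Carrier) → List Dir → ℕ → ℕ → List Piece
  stdPieces a w r s = X₀ ∷ (mapB a w (bends w r s) ++ (Xₘ₊₁ ∷ []))
    where
      X₀ = if wAt w r ==ᴰ N then h₋ (B a (P w r)) else v₋ (B a (P w r))
      Xₘ₊₁ = if wAt w s ==ᴰ N then h₊ (B a (P w (suc s))) else v₊ (B a (P w (suc s)))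

  η : (ℕ → ℕ → Carrier) → List Dir → ℕ → ℕ → ℕ
  η a w r s = drhRows (stdPieces a w r s)

  Std : (ℕ → ℕ → Carrier) → List Dir → ℕ → ℕ → ℕ → ℕ → Carrier
  Std a w r s = drhMat (stdPieces a w r s)

  cc : (ℕ → ℕ → Carrier) → List Dir → ℕ → ℕ → Carrier
  cc a w r s = negPow (((η a w r s ∸ 1) * (η a w r s ∸ 2)) / 2)
               ⊛ det (η a w r s) (Std a w r s)

{-# OPTIONS --safe #-}
module Submission where

-- Fix r ≤ t ≤ s. The pieces of Std([r,s]) are X₀, the blocks of the bends in
-- (r, t], the blocks of the bends in (t, s] and a final domino. Laplace
-- expansion shows that the signed determinant is linear in the two entries of
-- the final domino, and that a block followed by a domino can be traded for a
-- domino alone, at the cost of a 2 × 2 linear map on the coefficients. Hence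
-- c([r,s]) = V(t,s) · U(r,t) with U(r,t), V(t,s) ∈ R² depending only on [r,t]
-- and on [t,s]. Taking t = max ρ ≤ min κ over the indices of the corollary,
-- its 3 × 3 matrix is a sum of two matrices of rank one, so its determinant
-- vanishes.

open import Defs
open import Data.Nat
  using (ℕ; zero; suc; _+_; _*_; _∸_; _⊔_; _≤_; _<_; _≤′_; ≤′-refl; ≤′-step; z≤n; s≤s; _<ᵇ_; _≤ᵇ_)
import Data.Nat.Properties as ℕ
open import Data.Nat.DivMod using (_/_; +-distrib-/-∣ʳ; m*n/n≡m)
open import Data.Nat.Divisibility using (divides)
open import Data.Bool using (Bool; true; false; if_then_else_; not; _∧_)
open import Data.Bool.Properties using (∧-zeroʳ)
open import Data.Product using (_×_; _,_; proj₁; proj₂)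
open import Data.Sum using (_⊎_; inj₁; inj₂; [_,_]′)
open import Data.List using (List; []; _∷_; _++_; map; length)
import Data.List.Properties as List
open import Data.Integer as ℤ using (ℤ; -[1+_]; _⊖_; _◃_; sign; ∣_∣)
import Data.Integer.Properties as ℤ
open import Data.Sign as Sign using (Sign)
open import Data.Maybe using (Maybe; nothing; just)
open import Relation.Nullary using (yes; no)
open import Algebra.Bundles using (CommutativeRing)
import Relation.Binary.Reasoning.Setoid as SetoidReasoning
import Algebra.Solver.Ring
open import Algebra.Solver.Ring.AlmostCommutativeRing
  using (fromCommutativeRing; _-Raw-AlmostCommutative⟶_)
import Algebra.Properties.Semiring.Mult as SemiringMult
import Algebra.Properties.Ring as RingProperties
import Algebra.Properties.AbelianGroup as AbelianGroupProperties
open import Relation.Binary.PropositionalEquality as ≡ using (_≡_)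

<ᵇ≡true : ∀ {m n} → m < n → (m <ᵇ n) ≡ true
<ᵇ≡true {zero}  {suc n} _         = ≡.refl
<ᵇ≡true {suc m} {suc n} (s≤s m<n) = <ᵇ≡true m<n

<ᵇ≡false : ∀ {m n} → n ≤ m → (m <ᵇ n) ≡ false
<ᵇ≡false {m}     {zero}  _         = ≡.refl
<ᵇ≡false {suc m} {suc n} (s≤s n≤m) = <ᵇ≡false n≤m

≤ᵇ≡true : ∀ {m n} → m ≤ n → (m ≤ᵇ n) ≡ true
≤ᵇ≡true {zero}              _ = ≡.refl
≤ᵇ≡true {suc m} {suc n} m≤n   = <ᵇ≡true m≤n

≤ᵇ≡false : ∀ {m n} → n < m → (m ≤ᵇ n) ≡ false
≤ᵇ≡false {suc m} (s≤s n≤m) = <ᵇ≡false n≤m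

skip : ℕ → ℕ → ℕ
skip j k = if k <ᵇ j then k else suc k

skip-< : ∀ {j k} → k < j → skip j k ≡ k
skip-< k<j rewrite <ᵇ≡true k<j = ≡.refl

skip-≥ : ∀ {j k} → j ≤ k → skip j k ≡ suc k
skip-≥ j≤k rewrite <ᵇ≡false j≤k = ≡.refl

skip-bound : ∀ j {k n} → k < n → skip j k < suc n
skip-bound j {k} k<n with k <ᵇ j
... | true  = ℕ.m≤n⇒m≤1+n k<n
... | false = s≤s k<n

ivl-+ : ∀ a m n → ivl a (m + n) ≡ ivl a m ++ ivl (a + m) n
ivl-+ a zero    n = ≡.cong (λ b → ivl b n) (≡.sym (ℕ.+-identityʳ a))
ivl-+ a (suc m) n = ≡.cong (a ∷_) (≡.trans (ivl-+ (suc a) m n)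
                                       (≡.cong (λ b → ivl (suc a) m ++ ivl b n) (≡.sym (ℕ.+-suc a m))))

filt-++ : ∀ p xs ys → filt p (xs ++ ys) ≡ filt p xs ++ filt p ys
filt-++ p []       ys = ≡.refl
filt-++ p (x ∷ xs) ys with p x
... | true  = ≡.cong (x ∷_) (filt-++ p xs ys)
... | false = filt-++ p xs ys

∸-split : ∀ {r t s} → r ≤ t → t ≤ s → s ∸ r ≡ (t ∸ r) + (s ∸ t)
∸-split {r} {t} {s} r≤t t≤s = begin
  s ∸ r             ≡⟨ ≡.cong (_∸ r) (≡.sym (ℕ.m∸n+n≡m t≤s)) ⟩
  (s ∸ t) + t ∸ r   ≡⟨ ℕ.+-∸-assoc (s ∸ t) r≤t ⟩
  (s ∸ t) + (t ∸ r) ≡⟨ ℕ.+-comm (s ∸ t) (t ∸ r) ⟩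
  (t ∸ r) + (s ∸ t) ∎
  where open ≡.≡-Reasoning

isBend : List Dir → ℕ → Bool
isBend w k = not (wAt w (k ∸ 1) ==ᴰ wAt w k)

bends-++ : ∀ w {r t s} → r ≤ t → t ≤ s → bends w r s ≡ bends w r t ++ bends w t s
bends-++ w {r} {t} {s} r≤t t≤s = begin
  filt (isBend w) (ivl (suc r) (s ∸ r))
    ≡⟨ ≡.cong (λ n → filt (isBend w) (ivl (suc r) n)) (∸-split r≤t t≤s) ⟩
  filt (isBend w) (ivl (suc r) ((t ∸ r) + (s ∸ t)))
    ≡⟨ ≡.cong (filt (isBend w)) (ivl-+ (suc r) (t ∸ r) (s ∸ t)) ⟩
  filt (isBend w) (ivl (suc r) (t ∸ r) ++ ivl (suc r + (t ∸ r)) (s ∸ t))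
    ≡⟨ filt-++ (isBend w) (ivl (suc r) (t ∸ r)) _ ⟩
  bends w r t ++ filt (isBend w) (ivl (suc (r + (t ∸ r))) (s ∸ t))
    ≡⟨ ≡.cong (λ b → bends w r t ++ filt (isBend w) (ivl (suc b) (s ∸ t))) (ℕ.m+[n∸m]≡n r≤t) ⟩
  bends w r t ++ bends w t s ∎
  where open ≡.≡-Reasoning

turn : Dir → Dir
turn N = E
turn E = N

turnEach : ∀ {a} {A : Set a} → Dir → List A → Dir
turnEach d []       = d
turnEach d (_ ∷ ks) = turnEach (turn d) ks

turnEach-++ : ∀ {a} {A : Set a} d (ks ls : List A) → turnEach d (ks ++ ls) ≡ turnEach (turnEach d ks) ls
turnEach-++ d []       ls = ≡.refl
turnEach-++ d (_ ∷ ks) ls = turnEach-++ (turn d) ks ls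

turnEach-bend : ∀ d d′ (k : ℕ) → turnEach d (if not (d ==ᴰ d′) then k ∷ [] else []) ≡ d′
turnEach-bend N N k = ≡.refl
turnEach-bend N E k = ≡.refl
turnEach-bend E N k = ≡.refl
turnEach-bend E E k = ≡.refl

turnEach-map : ∀ {a b} {A : Set a} {B : Set b} d (f : A → B) xs → turnEach d (map f xs) ≡ turnEach d xs
turnEach-map d f []       = ≡.refl
turnEach-map d f (_ ∷ xs) = turnEach-map (turn d) f xs

turnEach-bends : ∀ w {r s} → r ≤′ s → turnEach (wAt w r) (bends w r s) ≡ wAt w s
turnEach-bends w {r} ≤′-refl =
  ≡.cong (λ n → turnEach (wAt w r) (filt (isBend w) (ivl (suc r) n))) (ℕ.n∸n≡0 r)
turnEach-bends w {r} {suc s} (≤′-step r≤′s) = begin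
  turnEach (wAt w r) (bends w r (suc s))
    ≡⟨ ≡.cong (turnEach (wAt w r)) (bends-++ w (ℕ.≤′⇒≤ r≤′s) (ℕ.n≤1+n s)) ⟩
  turnEach (wAt w r) (bends w r s ++ bends w s (suc s))
    ≡⟨ turnEach-++ (wAt w r) (bends w r s) _ ⟩
  turnEach (turnEach (wAt w r) (bends w r s)) (bends w s (suc s))
    ≡⟨ ≡.cong (λ d → turnEach d (bends w s (suc s))) (turnEach-bends w r≤′s) ⟩
  turnEach (wAt w s) (bends w s (suc s))
    ≡⟨ ≡.cong (λ n → turnEach (wAt w s) (filt (isBend w) (ivl (suc s) n))) (ℕ.m+n∸n≡m 1 s) ⟩
  turnEach (wAt w s) (if not (wAt w s ==ᴰ wAt w (suc s)) then suc s ∷ [] else [])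
    ≡⟨ turnEach-bend (wAt w s) (wAt w (suc s)) (suc s) ⟩
  wAt w (suc s) ∎
  where open ≡.≡-Reasoning

signExp : ℕ → ℕ
signExp η = ((η ∸ 1) * (η ∸ 2)) / 2

signExp-suc : ∀ k → signExp (3 + k) ≡ signExp (2 + k) + suc k
signExp-suc k = begin
  (suc (suc k) * suc k) / 2             ≡⟨ ≡.cong (_/ 2) (ℕ.*-comm (suc (suc k)) (suc k)) ⟩
  (suc k * (2 + k)) / 2                 ≡⟨ ≡.cong (λ m → (suc k * m) / 2) (ℕ.+-comm 2 k) ⟩
  (suc k * (k + 2)) / 2                 ≡⟨ ≡.cong (_/ 2) (ℕ.*-distribˡ-+ (suc k) k 2) ⟩
  (suc k * k + suc k * 2) / 2           ≡⟨ +-distrib-/-∣ʳ (suc k * k) (divides (suc k) ≡.refl) ⟩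
  signExp (2 + k) + (suc k * 2) / 2     ≡⟨ ≡.cong (signExp (2 + k) +_) (m*n/n≡m (suc k) 2) ⟩
  signExp (2 + k) + suc k ∎
  where open ≡.≡-Reasoning

-- The ring solver closes an identity by `refl` on normal forms, so their
-- coefficients must compute; with coefficients in R itself they do not
-- (- 1# ⊛ - 1# is not 1# by definition), hence integer coefficients.
module IntegerCoefficients {c ℓ} (R : CommutativeRing c ℓ) where
  open CommutativeRing R renaming (_+_ to _⊕_; _*_ to _⊛_; -_ to ⊖_; _-_ to _⊝_)
  open SemiringMult semiring using (×-homo-+; ×1-homo-*) renaming (_×_ to _×ᴿ_)
  open RingProperties ring using (-0#≈0#; -‿involutive; -1*x≈-x)
  open AbelianGroupProperties +-abelianGroup using (⁻¹-∙-comm)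
  open SetoidReasoning setoid

  ⟦_⟧ : ℤ → Carrier
  ⟦ ℤ.+ n ⟧    = n ×ᴿ 1#
  ⟦ -[1+ n ] ⟧ = ⊖ (suc n ×ᴿ 1#)

  private
    1+x-1+y : ∀ x y → (1# ⊕ x) ⊝ (1# ⊕ y) ≈ x ⊝ y
    1+x-1+y x y = begin
      (1# ⊕ x) ⊝ (1# ⊕ y)        ≈⟨ +-congˡ (⁻¹-∙-comm 1# y) ⟨
      (1# ⊕ x) ⊕ (⊖ 1# ⊕ ⊖ y)    ≈⟨ +-assoc 1# x _ ⟩
      1# ⊕ (x ⊕ (⊖ 1# ⊕ ⊖ y))    ≈⟨ +-congˡ (+-assoc x (⊖ 1#) (⊖ y)) ⟨
      1# ⊕ ((x ⊕ ⊖ 1#) ⊕ ⊖ y)    ≈⟨ +-congˡ (+-congʳ (+-comm x (⊖ 1#))) ⟩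
      1# ⊕ ((⊖ 1# ⊕ x) ⊕ ⊖ y)    ≈⟨ +-congˡ (+-assoc (⊖ 1#) x (⊖ y)) ⟩
      1# ⊕ (⊖ 1# ⊕ (x ⊝ y))      ≈⟨ +-assoc 1# (⊖ 1#) _ ⟨
      (1# ⊝ 1#) ⊕ (x ⊝ y)        ≈⟨ +-congʳ (-‿inverseʳ 1#) ⟩
      0# ⊕ (x ⊝ y)               ≈⟨ +-identityˡ _ ⟩
      x ⊝ y                      ∎

  ⊖-homo : ∀ m n → ⟦ m ⊖ n ⟧ ≈ m ×ᴿ 1# ⊝ n ×ᴿ 1#
  ⊖-homo zero    zero    = sym (-‿inverseʳ 0#)
  ⊖-homo zero    (suc n) = sym (+-identityˡ _)
  ⊖-homo (suc m) zero    = sym (trans (+-congˡ -0#≈0#) (+-identityʳ _))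
  ⊖-homo (suc m) (suc n) = begin
    ⟦ suc m ⊖ suc n ⟧        ≡⟨ ≡.cong ⟦_⟧ (ℤ.[1+m]⊖[1+n]≡m⊖n m n) ⟩
    ⟦ m ⊖ n ⟧                ≈⟨ ⊖-homo m n ⟩
    m ×ᴿ 1# ⊝ n ×ᴿ 1#          ≈⟨ 1+x-1+y _ _ ⟨
    suc m ×ᴿ 1# ⊝ suc n ×ᴿ 1#  ∎

  +-homo : ∀ i j → ⟦ i ℤ.+ j ⟧ ≈ ⟦ i ⟧ ⊕ ⟦ j ⟧
  +-homo (ℤ.+ m)  (ℤ.+ n)  = ×-homo-+ 1# m n
  +-homo (ℤ.+ m)  -[1+ n ] = ⊖-homo m (suc n)
  +-homo -[1+ m ] (ℤ.+ n)  = trans (⊖-homo n (suc m)) (+-comm _ _)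
  +-homo -[1+ m ] -[1+ n ] = begin
    ⊖ (suc (suc (m + n)) ×ᴿ 1#)       ≡⟨ ≡.cong (λ k → ⊖ (k ×ᴿ 1#)) (ℕ.+-suc (suc m) n) ⟨
    ⊖ ((suc m + suc n) ×ᴿ 1#)         ≈⟨ -‿cong (×-homo-+ 1# (suc m) (suc n)) ⟩
    ⊖ (suc m ×ᴿ 1# ⊕ suc n ×ᴿ 1#)      ≈⟨ ⁻¹-∙-comm _ _ ⟨
    ⊖ (suc m ×ᴿ 1#) ⊕ ⊖ (suc n ×ᴿ 1#)  ∎

  signValue : Sign → Carrier
  signValue Sign.+ = 1#
  signValue Sign.- = ⊖ 1#

  ◃-homo : ∀ s n → ⟦ s ◃ n ⟧ ≈ signValue s ⊛ (n ×ᴿ 1#)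
  ◃-homo Sign.- zero    = sym (zeroʳ _)
  ◃-homo Sign.+ zero    = sym (zeroʳ _)
  ◃-homo Sign.- (suc n) = sym (-1*x≈-x _)
  ◃-homo Sign.+ (suc n) = sym (*-identityˡ _)

  signValue-homo : ∀ s t → signValue (s Sign.* t) ≈ signValue s ⊛ signValue t
  signValue-homo Sign.- Sign.- = trans (sym (-‿involutive 1#)) (sym (-1*x≈-x (⊖ 1#)))
  signValue-homo Sign.- Sign.+ = sym (*-identityʳ _)
  signValue-homo Sign.+ Sign.- = sym (*-identityˡ _)
  signValue-homo Sign.+ Sign.+ = sym (*-identityˡ _)

  ⟦⟧-sign-abs : ∀ i → ⟦ i ⟧ ≈ signValue (sign i) ⊛ (∣ i ∣ ×ᴿ 1#)
  ⟦⟧-sign-abs i = trans (reflexive (≡.cong ⟦_⟧ (≡.sym (ℤ.◃-inverse i)))) (◃-homo (sign i) ∣ i ∣)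

  *-homo : ∀ i j → ⟦ i ℤ.* j ⟧ ≈ ⟦ i ⟧ ⊛ ⟦ j ⟧
  *-homo i j = begin
    ⟦ (sign i Sign.* sign j) ◃ (∣ i ∣ * ∣ j ∣) ⟧
      ≈⟨ ◃-homo (sign i Sign.* sign j) (∣ i ∣ * ∣ j ∣) ⟩
    signValue (sign i Sign.* sign j) ⊛ ((∣ i ∣ * ∣ j ∣) ×ᴿ 1#)
      ≈⟨ *-cong (signValue-homo (sign i) (sign j)) (×1-homo-* ∣ i ∣ ∣ j ∣) ⟩
    (signValue (sign i) ⊛ signValue (sign j)) ⊛ ((∣ i ∣ ×ᴿ 1#) ⊛ (∣ j ∣ ×ᴿ 1#))
      ≈⟨ interchange _ _ _ _ ⟩
    (signValue (sign i) ⊛ (∣ i ∣ ×ᴿ 1#)) ⊛ (signValue (sign j) ⊛ (∣ j ∣ ×ᴿ 1#))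
      ≈⟨ *-cong (⟦⟧-sign-abs i) (⟦⟧-sign-abs j) ⟨
    ⟦ i ⟧ ⊛ ⟦ j ⟧ ∎
    where
    interchange : ∀ a b x y → (a ⊛ b) ⊛ (x ⊛ y) ≈ (a ⊛ x) ⊛ (b ⊛ y)
    interchange a b x y = begin
      (a ⊛ b) ⊛ (x ⊛ y)  ≈⟨ *-assoc a b _ ⟩
      a ⊛ (b ⊛ (x ⊛ y))  ≈⟨ *-congˡ (trans (sym (*-assoc b x y)) (*-congʳ (*-comm b x))) ⟩
      a ⊛ ((x ⊛ b) ⊛ y)  ≈⟨ *-congˡ (*-assoc x b y) ⟩
      a ⊛ (x ⊛ (b ⊛ y))  ≈⟨ *-assoc a x _ ⟨
      (a ⊛ x) ⊛ (b ⊛ y)  ∎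

  -‿homo : ∀ i → ⟦ ℤ.- i ⟧ ≈ ⊖ ⟦ i ⟧
  -‿homo -[1+ n ]        = sym (-‿involutive _)
  -‿homo (ℤ.+ zero)      = sym -0#≈0#
  -‿homo (ℤ.+ suc n)     = refl

  homomorphism : ℤ.+-*-rawRing -Raw-AlmostCommutative⟶ fromCommutativeRing R
  homomorphism = record
    { ⟦_⟧ = ⟦_⟧ ; +-homo = +-homo ; *-homo = *-homo ; -‿homo = -‿homo
    ; 0-homo = refl ; 1-homo = +-identityʳ 1# }

  ⟦⟧-≟ : ∀ i j → Maybe (⟦ i ⟧ ≈ ⟦ j ⟧)
  ⟦⟧-≟ i j with i ℤ.≟ j
  ... | yes i≡j = just (reflexive (≡.cong ⟦_⟧ i≡j))
  ... | no  _   = nothing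

  open Algebra.Solver.Ring ℤ.+-*-rawRing (fromCommutativeRing R) homomorphism ⟦⟧-≟ public
    using (solve; _:=_; _:+_; _:*_; :-_; _:-_; con)

module Determinant {c ℓ} (R : CommutativeRing c ℓ) where
  open CommutativeRing R renaming (_+_ to _⊕_; _*_ to _⊛_; -_ to ⊖_)
  open WithRing R
  open IntegerCoefficients R public using (solve; _:=_; _:+_; _:*_; :-_; _:-_; con)
  open SetoidReasoning setoid

  Matrix : Set c
  Matrix = ℕ → ℕ → Carrier

  negPow-+ : ∀ m n → negPow (m + n) ≈ negPow m ⊛ negPow n
  negPow-+ zero    n = sym (*-identityˡ _)
  negPow-+ (suc m) n = trans (-‿cong (negPow-+ m n))
    (solve 2 (λ a b → :- (a :* b) := (:- a) :* b) refl (negPow m) (negPow n))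

  negPow-square : ∀ n → negPow n ⊛ negPow n ≈ 1#
  negPow-square zero    = *-identityˡ 1#
  negPow-square (suc n) = trans (solve 1 (λ a → (:- a) :* (:- a) := a :* a) refl (negPow n)) (negPow-square n)

  sumTo-cong : ∀ n {f g} → (∀ j → j < n → f j ≈ g j) → sumTo n f ≈ sumTo n g
  sumTo-cong zero    f≈g = refl
  sumTo-cong (suc n) f≈g = +-cong (sumTo-cong n (λ j j<n → f≈g j (ℕ.m≤n⇒m≤1+n j<n))) (f≈g n ℕ.≤-refl)

  sumTo-≈0 : ∀ n {f} → (∀ j → j < n → f j ≈ 0#) → sumTo n f ≈ 0#
  sumTo-≈0 zero    f≈0 = refl
  sumTo-≈0 (suc n) f≈0 =
    trans (+-cong (sumTo-≈0 n (λ j j<n → f≈0 j (ℕ.m≤n⇒m≤1+n j<n))) (f≈0 n ℕ.≤-refl)) (+-identityʳ 0#)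

  sumTo-*ˡ : ∀ n a {f g} → (∀ j → j < n → g j ≈ a ⊛ f j) → sumTo n g ≈ a ⊛ sumTo n f
  sumTo-*ˡ zero    a g≈af = sym (zeroʳ a)
  sumTo-*ˡ (suc n) a g≈af =
    trans (+-cong (sumTo-*ˡ n a (λ j j<n → g≈af j (ℕ.m≤n⇒m≤1+n j<n))) (g≈af n ℕ.≤-refl)) (sym (distribˡ a _ _))

  zero-combination : ∀ a b → 0# ≈ a ⊛ 0# ⊕ b ⊛ 0#
  zero-combination a b = sym (trans (+-cong (zeroʳ a) (zeroʳ b)) (+-identityʳ 0#))

  sumTo-linear : ∀ n a b {f g h} → (∀ j → j < n → h j ≈ a ⊛ f j ⊕ b ⊛ g j) →
                 sumTo n h ≈ a ⊛ sumTo n f ⊕ b ⊛ sumTo n g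
  sumTo-linear zero    a b _ = zero-combination a b
  sumTo-linear (suc n) a b {f} {g} h≈ = begin
    sumTo n _ ⊕ _
      ≈⟨ +-cong (sumTo-linear n a b (λ j j<n → h≈ j (ℕ.m≤n⇒m≤1+n j<n))) (h≈ n ℕ.≤-refl) ⟩
    (a ⊛ sumTo n f ⊕ b ⊛ sumTo n g) ⊕ (a ⊛ f n ⊕ b ⊛ g n)
      ≈⟨ solve 6 (λ a b x y u v → (a :* x :+ b :* y) :+ (a :* u :+ b :* v) := a :* (x :+ u) :+ b :* (y :+ v))
               refl a b (sumTo n f) (sumTo n g) (f n) (g n) ⟩
    a ⊛ (sumTo n f ⊕ f n) ⊕ b ⊛ (sumTo n g ⊕ g n) ∎

  laplaceTerm : ℕ → Matrix → ℕ → Carrier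
  laplaceTerm n M j = negPow j ⊛ (M 0 j ⊛ det n (minor j M))

  laplaceTerm-entry≈0 : ∀ n M j → M 0 j ≈ 0# → laplaceTerm n M j ≈ 0#
  laplaceTerm-entry≈0 n M j m≈0 = trans (*-congˡ (trans (*-congʳ m≈0) (zeroˡ _))) (zeroʳ _)

  laplaceTerm-minor≈0 : ∀ n M j → det n (minor j M) ≈ 0# → laplaceTerm n M j ≈ 0#
  laplaceTerm-minor≈0 n M j d≈0 = trans (*-congˡ (trans (*-congˡ d≈0) (zeroʳ _))) (zeroʳ _)

  det-cong : ∀ n {M W} → (∀ i j → i < n → j < n → M i j ≈ W i j) → det n M ≈ det n W
  det-cong zero    M≈W = refl
  det-cong (suc n) M≈W = sumTo-cong (suc n) (λ j j<n → *-congˡ (*-cong (M≈W 0 j (s≤s z≤n) j<n)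
    (det-cong n (λ i k i<n k<n → M≈W (suc i) _ (s≤s i<n) (skip-bound j k<n)))))

  mutual
    det-lastCol≈0 : ∀ n M → (∀ i → i < suc n → M i n ≈ 0#) → det (suc n) M ≈ 0#
    det-lastCol≈0 n M col≈0 =
      trans (+-cong (laplaceInit≈0 n M (λ i _ → col≈0 i)) (laplaceTerm-entry≈0 n M n (col≈0 0 (s≤s z≤n))))
            (+-identityʳ 0#)

    laplaceInit≈0 : ∀ n M → (∀ i → 0 < i → i < suc n → M i n ≈ 0#) → sumTo n (laplaceTerm n M) ≈ 0#
    laplaceInit≈0 zero    M col≈0 = refl
    laplaceInit≈0 (suc n) M col≈0 = sumTo-≈0 (suc n) (λ j j<n → laplaceTerm-minor≈0 (suc n) M j
      (det-lastCol≈0 n (minor j M) (λ i i<n →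
        trans (reflexive (≡.cong (M (suc i)) (skip-≥ (ℕ.≤-pred j<n)))) (col≈0 (suc i) (s≤s z≤n) (s≤s i<n)))))

  det-lastCol-top : ∀ n M → (∀ i → 0 < i → i < suc n → M i n ≈ 0#) →
                    det (suc n) M ≈ laplaceTerm n M n
  det-lastCol-top n M col≈0 = trans (+-congʳ (laplaceInit≈0 n M col≈0)) (+-identityˡ _)

  private
    scale-term : ∀ s m a b x y → s ⊛ (m ⊛ (a ⊛ x ⊕ b ⊛ y)) ≈ a ⊛ (s ⊛ (m ⊛ x)) ⊕ b ⊛ (s ⊛ (m ⊛ y))
    scale-term = solve 6 (λ s m a b x y →
      s :* (m :* (a :* x :+ b :* y)) := a :* (s :* (m :* x)) :+ b :* (s :* (m :* y))) refl

    scale-entry : ∀ s a b u v d → s ⊛ ((a ⊛ u ⊕ b ⊛ v) ⊛ d) ≈ a ⊛ (s ⊛ (u ⊛ d)) ⊕ b ⊛ (s ⊛ (v ⊛ d))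
    scale-entry = solve 6 (λ s a b u v d →
      s :* ((a :* u :+ b :* v) :* d) := a :* (s :* (u :* d)) :+ b :* (s :* (v :* d))) refl

    regroup : ∀ a b x y u v → (a ⊛ x ⊕ b ⊛ y) ⊕ (a ⊛ u ⊕ b ⊛ v) ≈ a ⊛ (x ⊕ u) ⊕ b ⊛ (y ⊕ v)
    regroup = solve 6 (λ a b x y u v →
      (a :* x :+ b :* y) :+ (a :* u :+ b :* v) := a :* (x :+ u) :+ b :* (y :+ v)) refl

  det-row₀-linear : ∀ n M U V a b →
    (∀ j → j < suc n → M 0 j ≈ a ⊛ U 0 j ⊕ b ⊛ V 0 j) →
    (∀ i j → i < n → j < suc n → M (suc i) j ≈ U (suc i) j) →
    (∀ i j → i < n → j < suc n → M (suc i) j ≈ V (suc i) j) →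
    det (suc n) M ≈ a ⊛ det (suc n) U ⊕ b ⊛ det (suc n) V
  det-row₀-linear n M U V a b row₀ M≈U M≈V = sumTo-linear (suc n) a b (λ j j<n → begin
    negPow j ⊛ (M 0 j ⊛ det n (minor j M))
      ≈⟨ *-congˡ (*-congʳ (row₀ j j<n)) ⟩
    negPow j ⊛ ((a ⊛ U 0 j ⊕ b ⊛ V 0 j) ⊛ det n (minor j M))
      ≈⟨ scale-entry _ a b _ _ _ ⟩
    a ⊛ (negPow j ⊛ (U 0 j ⊛ det n (minor j M))) ⊕ b ⊛ (negPow j ⊛ (V 0 j ⊛ det n (minor j M)))
      ≈⟨ +-cong (*-congˡ (*-congˡ (*-congˡ (det-cong n (λ i k i<n k<n → M≈U i _ i<n (skip-bound j k<n))))))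
                (*-congˡ (*-congˡ (*-congˡ (det-cong n (λ i k i<n k<n → M≈V i _ i<n (skip-bound j k<n)))))) ⟩
    a ⊛ laplaceTerm n U j ⊕ b ⊛ laplaceTerm n V j ∎)

  mutual
    det-lastCol-linear : ∀ n M U V a b →
      (∀ i → i < suc n → M i n ≈ a ⊛ U i n ⊕ b ⊛ V i n) →
      (∀ i j → i < suc n → j < n → M i j ≈ U i j) →
      (∀ i j → i < suc n → j < n → M i j ≈ V i j) →
      det (suc n) M ≈ a ⊛ det (suc n) U ⊕ b ⊛ det (suc n) V
    det-lastCol-linear n M U V a b lastCol M≈U M≈V =
      trans (+-cong (laplaceInit-linear n M U V a b lastCol M≈U M≈V) lastTerm) (regroup a b _ _ _ _)
      where
      sameMinor : ∀ W → (∀ i j → i < suc n → j < n → M i j ≈ W i j) →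
                  ∀ i k → i < n → k < n → minor n M i k ≈ minor n W i k
      sameMinor W M≈W i k i<n k<n = begin
        M (suc i) (skip n k)  ≡⟨ ≡.cong (M (suc i)) (skip-< k<n) ⟩
        M (suc i) k           ≈⟨ M≈W (suc i) k (s≤s i<n) k<n ⟩
        W (suc i) k           ≡⟨ ≡.cong (W (suc i)) (skip-< k<n) ⟨
        W (suc i) (skip n k)  ∎
      lastTerm : laplaceTerm n M n ≈ a ⊛ laplaceTerm n U n ⊕ b ⊛ laplaceTerm n V n
      lastTerm = begin
        negPow n ⊛ (M 0 n ⊛ det n (minor n M))
          ≈⟨ *-congˡ (*-congʳ (lastCol 0 (s≤s z≤n))) ⟩
        negPow n ⊛ ((a ⊛ U 0 n ⊕ b ⊛ V 0 n) ⊛ det n (minor n M))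
          ≈⟨ scale-entry _ a b _ _ _ ⟩
        a ⊛ (negPow n ⊛ (U 0 n ⊛ det n (minor n M))) ⊕ b ⊛ (negPow n ⊛ (V 0 n ⊛ det n (minor n M)))
          ≈⟨ +-cong (*-congˡ (*-congˡ (*-congˡ (det-cong n (sameMinor U M≈U)))))
                    (*-congˡ (*-congˡ (*-congˡ (det-cong n (sameMinor V M≈V))))) ⟩
        a ⊛ laplaceTerm n U n ⊕ b ⊛ laplaceTerm n V n ∎

    laplaceInit-linear : ∀ n M U V a b →
      (∀ i → i < suc n → M i n ≈ a ⊛ U i n ⊕ b ⊛ V i n) →
      (∀ i j → i < suc n → j < n → M i j ≈ U i j) →
      (∀ i j → i < suc n → j < n → M i j ≈ V i j) →
      sumTo n (laplaceTerm n M) ≈ a ⊛ sumTo n (laplaceTerm n U) ⊕ b ⊛ sumTo n (laplaceTerm n V)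
    laplaceInit-linear zero    M U V a b _ _ _ = zero-combination a b
    laplaceInit-linear (suc n) M U V a b lastCol M≈U M≈V = sumTo-linear (suc n) a b (λ j j<n → begin
      negPow j ⊛ (M 0 j ⊛ det (suc n) (minor j M))
        ≈⟨ *-congˡ (*-congˡ (det-lastCol-linear n (minor j M) (minor j U) (minor j V) a b
             (λ i i<n → ≡.subst (λ k → M (suc i) k ≈ a ⊛ U (suc i) k ⊕ b ⊛ V (suc i) k)
                                (≡.sym (skip-≥ (ℕ.≤-pred j<n))) (lastCol (suc i) (s≤s i<n)))
             (λ i k i<n k<n → M≈U (suc i) _ (s≤s i<n) (skip-bound j k<n))
             (λ i k i<n k<n → M≈V (suc i) _ (s≤s i<n) (skip-bound j k<n)))) ⟩
      negPow j ⊛ (M 0 j ⊛ (a ⊛ det (suc n) (minor j U) ⊕ b ⊛ det (suc n) (minor j V)))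
        ≈⟨ scale-term _ _ a b _ _ ⟩
      a ⊛ (negPow j ⊛ (M 0 j ⊛ det (suc n) (minor j U))) ⊕ b ⊛ (negPow j ⊛ (M 0 j ⊛ det (suc n) (minor j V)))
        ≈⟨ +-cong (*-congˡ (*-congˡ (*-congʳ (M≈U 0 j (s≤s z≤n) j<n))))
                  (*-congˡ (*-congˡ (*-congʳ (M≈V 0 j (s≤s z≤n) j<n)))) ⟩
      a ⊛ laplaceTerm (suc n) U j ⊕ b ⊛ laplaceTerm (suc n) V j ∎)

  -- `det 3` written over an arbitrary signature: at the operations of R it is
  -- `det 3` by definition, at solver expressions it can be normalised.
  module Unfolded₃ {a} {A : Set a} (_+′_ _*′_ : A → A → A) (-′_ : A → A) (0′ 1′ : A) where
    det₂′ : A → A → A → A → A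
    det₂′ a b c d = (0′ +′ (1′ *′ (a *′ (0′ +′ (1′ *′ (d *′ 1′))))))
                    +′ ((-′ 1′) *′ (b *′ (0′ +′ (1′ *′ (c *′ 1′)))))

    det₃′ : (ℕ → ℕ → A) → A
    det₃′ M = ((0′ +′ (1′ *′ (M 0 0 *′ det₂′ (M 1 1) (M 1 2) (M 2 1) (M 2 2))))
               +′ ((-′ 1′) *′ (M 0 1 *′ det₂′ (M 1 0) (M 1 2) (M 2 0) (M 2 2))))
               +′ ((-′ (-′ 1′)) *′ (M 0 2 *′ det₂′ (M 1 0) (M 1 1) (M 2 0) (M 2 1)))

    pick : ℕ → A → A → A → A
    pick zero          x _ _ = x
    pick (suc zero)    _ y _ = y
    pick (suc (suc _)) _ _ z = z

  private
    det₃′-rank₂ : ∀ one u₀ u₁ u₂ v₀ v₁ v₂ p₀ p₁ p₂ q₀ q₁ q₂ → let open Unfolded₃ _⊕_ _⊛_ ⊖_ 0# one in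
      det₃′ (λ i j → pick j p₀ p₁ p₂ ⊛ pick i u₀ u₁ u₂ ⊕ pick j q₀ q₁ q₂ ⊛ pick i v₀ v₁ v₂) ≈ 0#
    det₃′-rank₂ = solve 13 (λ one u₀ u₁ u₂ v₀ v₁ v₂ p₀ p₁ p₂ q₀ q₁ q₂ →
      let open Unfolded₃ _:+_ _:*_ :-_ (con (ℤ.+ 0)) one in
      det₃′ (λ i j → pick j p₀ p₁ p₂ :* pick i u₀ u₁ u₂ :+ pick j q₀ q₁ q₂ :* pick i v₀ v₁ v₂)
        := con (ℤ.+ 0)) refl

  det₃-rank₂ : ∀ (u v p q : ℕ → Carrier) → det 3 (λ i j → p j ⊛ u i ⊕ q j ⊛ v i) ≈ 0#
  det₃-rank₂ u v p q = det₃′-rank₂ 1# (u 0) (u 1) (u 2) (v 0) (v 1) (v 2) (p 0) (p 1) (p 2) (q 0) (q 1) (q 2)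

module Layout {c ℓ} (R : CommutativeRing c ℓ) where
  open CommutativeRing R using (0#)
  open WithRing R
  open Determinant R using (Matrix)

  block hdom vdom : Matrix → Piece
  block b = piece 2 2 b
  hdom f  = piece 1 2 f
  vdom f  = piece 2 1 f

  -- rows counted from the top, whereas `cellAt` counts them from the bottom
  matrixOf : List Placed → ℕ → Matrix
  matrixOf ps n i j = cellAt ps (n ∸ suc i) j

  data Outside (by bx : ℕ) (X : Piece) (Y j : ℕ) : Set where
    under   : Y < by → Outside by bx X Y j
    over    : by + rows X ≤ Y → Outside by bx X Y j
    leftOf  : j < bx → Outside by bx X Y j
    rightOf : bx + cols X ≤ j → Outside by bx X Y j

  cellAt-inside : ∀ by bx X ps Y j → by ≤ Y → Y < by + rows X → bx ≤ j → j < bx + cols X →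
                  cellAt ((by , bx , X) ∷ ps) Y j ≡ ent X (rows X ∸ suc (Y ∸ by)) (j ∸ bx)
  cellAt-inside by bx X ps Y j by≤Y Y<top bx≤j j<right
    rewrite ≤ᵇ≡true by≤Y | <ᵇ≡true Y<top | ≤ᵇ≡true bx≤j | <ᵇ≡true j<right = ≡.refl

  cellAt-outside : ∀ by bx X ps Y j → Outside by bx X Y j → cellAt ((by , bx , X) ∷ ps) Y j ≡ cellAt ps Y j
  cellAt-outside by bx X ps Y j (under Y<by) rewrite ≤ᵇ≡false Y<by = ≡.refl
  cellAt-outside by bx X ps Y j (over top≤Y)
    rewrite <ᵇ≡false top≤Y | ∧-zeroʳ (by ≤ᵇ Y) = ≡.refl
  cellAt-outside by bx X ps Y j (leftOf j<bx)
    rewrite ≤ᵇ≡false j<bx | ∧-zeroʳ (Y <ᵇ by + rows X) | ∧-zeroʳ (by ≤ᵇ Y) = ≡.refl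
  cellAt-outside by bx X ps Y j (rightOf right≤j)
    rewrite <ᵇ≡false right≤j | ∧-zeroʳ (bx ≤ᵇ j) | ∧-zeroʳ (Y <ᵇ by + rows X) | ∧-zeroʳ (by ≤ᵇ Y) = ≡.refl

  cellAt-++-above : ∀ ps qs Y j → heightOf ps ≤ Y → cellAt (ps ++ qs) Y j ≡ cellAt qs Y j
  cellAt-++-above []                  qs Y j _ = ≡.refl
  cellAt-++-above ((by , bx , X) ∷ ps) qs Y j h≤Y =
    ≡.trans (cellAt-outside by bx X (ps ++ qs) Y j (over (ℕ.≤-trans (ℕ.m≤m⊔n _ _) h≤Y)))
            (cellAt-++-above ps qs Y j (ℕ.≤-trans (ℕ.m≤n⊔m _ _) h≤Y))

  cellAt-++-right : ∀ ps qs Y j → widthOf ps ≤ j → cellAt (ps ++ qs) Y j ≡ cellAt qs Y j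
  cellAt-++-right []                  qs Y j _ = ≡.refl
  cellAt-++-right ((by , bx , X) ∷ ps) qs Y j w≤j =
    ≡.trans (cellAt-outside by bx X (ps ++ qs) Y j (rightOf (ℕ.≤-trans (ℕ.m≤m⊔n _ _) w≤j)))
            (cellAt-++-right ps qs Y j (ℕ.≤-trans (ℕ.m≤n⊔m _ _) w≤j))

  cellAt-beyondWidth : ∀ ps Y j → widthOf ps ≤ j → cellAt ps Y j ≡ 0#
  cellAt-beyondWidth ps Y j w≤j =
    ≡.trans (≡.cong (λ qs → cellAt qs Y j) (≡.sym (List.++-identityʳ ps))) (cellAt-++-right ps [] Y j w≤j)

  cellAt-++-vacant : ∀ ps qs Y j → cellAt qs Y j ≡ 0# → cellAt (ps ++ qs) Y j ≡ cellAt ps Y j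
  cellAt-++-vacant []                  qs Y j vacant = vacant
  cellAt-++-vacant ((by , bx , X) ∷ ps) qs Y j vacant
    with (by ≤ᵇ Y) ∧ ((Y <ᵇ by + rows X) ∧ ((bx ≤ᵇ j) ∧ (j <ᵇ bx + cols X)))
  ... | true  = ≡.refl
  ... | false = cellAt-++-vacant ps qs Y j vacant

  heightOf-++ : ∀ ps qs → heightOf (ps ++ qs) ≡ heightOf ps ⊔ heightOf qs
  heightOf-++ []                  qs = ≡.refl
  heightOf-++ ((by , bx , X) ∷ ps) qs =
    ≡.trans (≡.cong ((by + rows X) ⊔_) (heightOf-++ ps qs)) (≡.sym (ℕ.⊔-assoc (by + rows X) _ _))

  widthOf-++ : ∀ ps qs → widthOf (ps ++ qs) ≡ widthOf ps ⊔ widthOf qs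
  widthOf-++ []                  qs = ≡.refl
  widthOf-++ ((by , bx , X) ∷ ps) qs =
    ≡.trans (≡.cong ((bx + cols X) ⊔_) (widthOf-++ ps qs)) (≡.sym (ℕ.⊔-assoc (bx + cols X) _ _))

  heightOf-++-≡ : ∀ ps qs {m n o} → heightOf ps ≡ m → heightOf qs ≡ n → m ⊔ n ≡ o → heightOf (ps ++ qs) ≡ o
  heightOf-++-≡ ps qs hp hq m⊔n≡o = ≡.trans (heightOf-++ ps qs) (≡.trans (≡.cong₂ _⊔_ hp hq) m⊔n≡o)

  widthOf-++-≡ : ∀ ps qs {m n o} → widthOf ps ≡ m → widthOf qs ≡ n → m ⊔ n ≡ o → widthOf (ps ++ qs) ≡ o
  widthOf-++-≡ ps qs wp wq m⊔n≡o = ≡.trans (widthOf-++ ps qs) (≡.trans (≡.cong₂ _⊔_ wp wq) m⊔n≡o)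

  Slot : Set
  Slot = Bool × ℕ × ℕ

  -- the arguments `layout` passes on after the given pieces: the direction
  -- flag and the position of the next piece
  slotAfter : Slot → List Piece → Slot
  slotAfter s                 []       = s
  slotAfter (above , by , bx) (X ∷ Xs) =
    slotAfter (not above , (if above then by + rows X else by) , (if above then bx else bx + cols X)) Xs

  layoutFrom : Slot → List Piece → List Placed
  layoutFrom (above , by , bx) = layout above by bx

  layoutFrom-++ : ∀ s Xs Ys → layoutFrom s (Xs ++ Ys) ≡ layoutFrom s Xs ++ layoutFrom (slotAfter s Xs) Ys
  layoutFrom-++ s                 []       Ys = ≡.refl
  layoutFrom-++ (above , by , bx) (X ∷ Xs) Ys = ≡.cong ((by , bx , X) ∷_) (layoutFrom-++ _ Xs Ys)

  slotAfter-++ : ∀ s Xs Ys → slotAfter s (Xs ++ Ys) ≡ slotAfter (slotAfter s Xs) Ys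
  slotAfter-++ s                 []       Ys = ≡.refl
  slotAfter-++ (above , by , bx) (X ∷ Xs) Ys = slotAfter-++ _ Xs Ys

module Staircase {c ℓ} (R : CommutativeRing c ℓ) where
  open CommutativeRing R renaming (_+_ to _⊕_; _*_ to _⊛_; -_ to ⊖_; _-_ to _⊝_)
  open WithRing R
  open Determinant R
  open Layout R
  open SetoidReasoning setoid

  private
    k+2≡2+k : ∀ k → k + 2 ≡ 2 + k
    k+2≡2+k k = ℕ.+-comm k 2

    1+k∸k≡1 : ∀ k → suc k ∸ k ≡ 1
    1+k∸k≡1 k = ℕ.m+n∸n≡m 1 k

    <k+2 : ∀ {j k} → j < 2 + k → j < k + 2
    <k+2 {j} {k} = ≡.subst (j <_) (≡.sym (k+2≡2+k k))

    2+k<k+2+1 : ∀ k → 2 + k < k + 2 + 1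
    2+k<k+2+1 k = ≡.subst (2 + k <_) (≡.sym (≡.trans (ℕ.+-comm (k + 2) 1) (≡.cong suc (k+2≡2+k k)))) ℕ.≤-refl

    2+k∸k+2≡0 : ∀ k → 2 + k ∸ (k + 2) ≡ 0
    2+k∸k+2≡0 k = ≡.trans (≡.cong (2 + k ∸_) (k+2≡2+k k)) (ℕ.n∸n≡0 (2 + k))

  δ : ℕ → ℕ → Carrier
  δ zero    zero    = 1#
  δ (suc i) (suc j) = δ i j
  δ _       _       = 0#

  expand-δ : ∀ (g : ℕ → Carrier) m → m < 2 → g m ≈ g 0 ⊛ δ 0 m ⊕ g 1 ⊛ δ 1 m
  expand-δ g 0 _ = sym (trans (+-cong (*-identityʳ _) (zeroʳ _)) (+-identityʳ _))
  expand-δ g 1 _ = sym (trans (+-cong (zeroʳ _) (*-identityʳ _)) (+-identityˡ _))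
  expand-δ g (suc (suc m)) (s≤s (s≤s ()))

  signedDet : ℕ → Matrix → Carrier
  signedDet n M = negPow (signExp n) ⊛ det n M

  negPow-signExp-suc : ∀ k → negPow (signExp (3 + k)) ≈ negPow (signExp (2 + k)) ⊛ negPow (suc k)
  negPow-signExp-suc k = trans (reflexive (≡.cong negPow (signExp-suc k))) (negPow-+ (signExp (2 + k)) (suc k))

  -- The sign (-1)^(1+k) met in the Laplace expansion of a staircase of size
  -- 3 + k is absorbed by the change of the sign exponent from 2 + k to 3 + k.
  resign : ∀ g s x y X Y → s ⊛ s ≈ 1# →
    (g ⊛ s) ⊛ ((s ⊛ x) ⊛ X ⊕ (⊖ s) ⊛ (y ⊛ Y)) ≈ x ⊛ (g ⊛ X) ⊝ y ⊛ (g ⊛ Y)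
  resign g s x y X Y s²≈1 = begin
    (g ⊛ s) ⊛ ((s ⊛ x) ⊛ X ⊕ (⊖ s) ⊛ (y ⊛ Y))
      ≈⟨ solve 6 (λ g s x y X Y → (g :* s) :* ((s :* x) :* X :+ (:- s) :* (y :* Y))
                                  := (s :* s) :* (x :* (g :* X) :- y :* (g :* Y))) refl g s x y X Y ⟩
    (s ⊛ s) ⊛ (x ⊛ (g ⊛ X) ⊝ y ⊛ (g ⊛ Y))  ≈⟨ trans (*-congʳ s²≈1) (*-identityˡ _) ⟩
    x ⊛ (g ⊛ X) ⊝ y ⊛ (g ⊛ Y)              ∎

  -- Coordinates (row, column) from the bottom left: `ps` fills rows ≤ k and
  -- columns ≤ 1 + k, and the next piece goes on top of its last one, at (1 + k, k).
  module Atop (ps : List Placed) (k : ℕ) (height : heightOf ps ≡ suc k) (width : widthOf ps ≡ 2 + k) where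
    ext₁ : Matrix → List Placed
    ext₁ f = (suc k , k , hdom f) ∷ []

    vdomRight : Matrix → List Placed
    vdomRight d = (suc k , k + 2 , vdom d) ∷ []

    ext₂ : Matrix → Matrix → List Placed
    ext₂ b d = (suc k , k , block b) ∷ vdomRight d

    private
      above-ps : ∀ {Y} → suc k ≤ Y → heightOf ps ≤ Y
      above-ps {Y} = ≡.subst (_≤ Y) (≡.sym height)

      below-top : ∀ i → k ∸ i < suc k
      below-top i = s≤s (ℕ.m∸n≤m k i)

    ext₁-lower : ∀ f i j → matrixOf (ps ++ ext₁ f) (2 + k) (suc i) j ≡ cellAt ps (k ∸ i) j
    ext₁-lower f i j = cellAt-++-vacant ps (ext₁ f) (k ∸ i) j
      (cellAt-outside (suc k) k (hdom f) [] (k ∸ i) j (under (below-top i)))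

    ext₂-lower : ∀ b d i j → matrixOf (ps ++ ext₂ b d) (3 + k) (2 + i) j ≡ cellAt ps (k ∸ i) j
    ext₂-lower b d i j = cellAt-++-vacant ps (ext₂ b d) (k ∸ i) j
      (≡.trans (cellAt-outside (suc k) k (block b) (vdomRight d) (k ∸ i) j (under (below-top i)))
               (cellAt-outside (suc k) (k + 2) (vdom d) [] (k ∸ i) j (under (below-top i))))

    ps-beyondWidth : ∀ Y → cellAt ps Y (2 + k) ≡ 0#
    ps-beyondWidth Y = cellAt-beyondWidth ps Y (2 + k) (ℕ.≤-reflexive width)

    ext₁-top-inside : ∀ f j → k ≤ j → j < k + 2 → matrixOf (ps ++ ext₁ f) (2 + k) 0 j ≡ f 0 (j ∸ k)
    ext₁-top-inside f j k≤j j<k+2 = ≡.trans (cellAt-++-above ps (ext₁ f) (suc k) j (above-ps ℕ.≤-refl))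
      (≡.trans (cellAt-inside (suc k) k (hdom f) [] (suc k) j ℕ.≤-refl
                              (≡.subst (suc k <_) (≡.sym (ℕ.+-comm (suc k) 1)) ℕ.≤-refl) k≤j j<k+2)
               (≡.cong (λ t → f (1 ∸ suc t) (j ∸ k)) (ℕ.n∸n≡0 k)))

    ext₁-top-outside : ∀ f j → j < k ⊎ k + 2 ≤ j → matrixOf (ps ++ ext₁ f) (2 + k) 0 j ≡ 0#
    ext₁-top-outside f j j∉ = ≡.trans (cellAt-++-above ps (ext₁ f) (suc k) j (above-ps ℕ.≤-refl))
      (cellAt-outside (suc k) k (hdom f) [] (suc k) j ([ leftOf , rightOf ]′ j∉))

    ext₂-upperRows : ∀ b d r j → r < 2 → j < 2 + k →
      matrixOf (ps ++ ext₂ b d) (3 + k) r j ≡ matrixOf (ps ++ ext₁ (λ _ → b r)) (2 + k) 0 j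
    ext₂-upperRows b d 0 j _ j<2+k with ℕ.<-≤-connex j k
    ... | inj₁ j<k = ≡.trans (cellAt-++-above ps (ext₂ b d) (2 + k) j (above-ps (ℕ.n≤1+n _)))
          (≡.trans (cellAt-outside (suc k) k (block b) (vdomRight d) (2 + k) j (leftOf j<k))
          (≡.trans (cellAt-outside (suc k) (k + 2) (vdom d) [] (2 + k) j (leftOf (ℕ.<-≤-trans j<k (ℕ.m≤m+n k 2))))
                   (≡.sym (ext₁-top-outside (λ _ → b 0) j (inj₁ j<k)))))
    ... | inj₂ k≤j = ≡.trans (cellAt-++-above ps (ext₂ b d) (2 + k) j (above-ps (ℕ.n≤1+n _)))
          (≡.trans (cellAt-inside (suc k) k (block b) (vdomRight d) (2 + k) j (ℕ.n≤1+n _)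
                                  (<k+2 {2 + k} {suc k} ℕ.≤-refl) k≤j (<k+2 j<2+k))
          (≡.trans (≡.cong (λ t → b (2 ∸ suc t) (j ∸ k)) (1+k∸k≡1 k))
                   (≡.sym (ext₁-top-inside (λ _ → b 0) j k≤j (<k+2 j<2+k)))))
    ext₂-upperRows b d 1 j _ j<2+k with ℕ.<-≤-connex j k
    ... | inj₁ j<k = ≡.trans (cellAt-++-above ps (ext₂ b d) (suc k) j (above-ps ℕ.≤-refl))
          (≡.trans (cellAt-outside (suc k) k (block b) (vdomRight d) (suc k) j (leftOf j<k))
          (≡.trans (cellAt-outside (suc k) (k + 2) (vdom d) [] (suc k) j (leftOf (ℕ.<-≤-trans j<k (ℕ.m≤m+n k 2))))
                   (≡.sym (ext₁-top-outside (λ _ → b 1) j (inj₁ j<k)))))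
    ... | inj₂ k≤j = ≡.trans (cellAt-++-above ps (ext₂ b d) (suc k) j (above-ps ℕ.≤-refl))
          (≡.trans (cellAt-inside (suc k) k (block b) (vdomRight d) (suc k) j ℕ.≤-refl
                                  (<k+2 {suc k} {suc k} (ℕ.n≤1+n _)) k≤j (<k+2 j<2+k))
          (≡.trans (≡.cong (λ t → b (2 ∸ suc t) (j ∸ k)) (ℕ.n∸n≡0 k))
                   (≡.sym (ext₁-top-inside (λ _ → b 1) j k≤j (<k+2 j<2+k)))))
    ext₂-upperRows b d (suc (suc r)) j (s≤s (s≤s ())) _

    ext₂-lastCol : ∀ b d i → i < 2 → matrixOf (ps ++ ext₂ b d) (3 + k) i (2 + k) ≡ d i 0
    ext₂-lastCol b d 0 _ = ≡.trans (cellAt-++-above ps (ext₂ b d) (2 + k) (2 + k) (above-ps (ℕ.n≤1+n _)))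
      (≡.trans (cellAt-outside (suc k) k (block b) (vdomRight d) (2 + k) (2 + k) (rightOf (ℕ.≤-reflexive (k+2≡2+k k))))
      (≡.trans (cellAt-inside (suc k) (k + 2) (vdom d) [] (2 + k) (2 + k) (ℕ.n≤1+n _)
                              (<k+2 {2 + k} {suc k} ℕ.≤-refl) (ℕ.≤-reflexive (k+2≡2+k k)) (2+k<k+2+1 k))
               (≡.cong₂ (λ t u → d (2 ∸ suc t) u) (1+k∸k≡1 k) (2+k∸k+2≡0 k))))
    ext₂-lastCol b d 1 _ = ≡.trans (cellAt-++-above ps (ext₂ b d) (suc k) (2 + k) (above-ps ℕ.≤-refl))
      (≡.trans (cellAt-outside (suc k) k (block b) (vdomRight d) (suc k) (2 + k) (rightOf (ℕ.≤-reflexive (k+2≡2+k k))))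
      (≡.trans (cellAt-inside (suc k) (k + 2) (vdom d) [] (suc k) (2 + k) ℕ.≤-refl
                              (<k+2 {suc k} {suc k} (ℕ.n≤1+n _)) (ℕ.≤-reflexive (k+2≡2+k k)) (2+k<k+2+1 k))
               (≡.cong₂ (λ t u → d (2 ∸ suc t) u) (ℕ.n∸n≡0 k) (2+k∸k+2≡0 k))))
    ext₂-lastCol b d (suc (suc i)) (s≤s (s≤s ()))

    ext₁-linear : ∀ f → signedDet (2 + k) (matrixOf (ps ++ ext₁ f) (2 + k)) ≈
      f 0 0 ⊛ signedDet (2 + k) (matrixOf (ps ++ ext₁ (λ _ → δ 0)) (2 + k))
      ⊕ f 0 1 ⊛ signedDet (2 + k) (matrixOf (ps ++ ext₁ (λ _ → δ 1)) (2 + k))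
    ext₁-linear f = trans (*-congˡ (det-row₀-linear (suc k) (M₁ f) (M₁ (λ _ → δ 0)) (M₁ (λ _ → δ 1)) (f 0 0) (f 0 1)
                                      top (λ i j _ _ → same-lower i j 0) (λ i j _ _ → same-lower i j 1)))
                          (solve 5 (λ g a b x y → g :* (a :* x :+ b :* y) := a :* (g :* x) :+ b :* (g :* y)) refl _ _ _ _ _)
      where
      M₁ : Matrix → Matrix
      M₁ f = matrixOf (ps ++ ext₁ f) (2 + k)
      same-lower : ∀ i j t → M₁ f (suc i) j ≈ M₁ (λ _ → δ t) (suc i) j
      same-lower i j t = reflexive (≡.trans (ext₁-lower f i j) (≡.sym (ext₁-lower _ i j)))
      top : ∀ j → j < 2 + k → M₁ f 0 j ≈ f 0 0 ⊛ M₁ (λ _ → δ 0) 0 j ⊕ f 0 1 ⊛ M₁ (λ _ → δ 1) 0 j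
      top j j<2+k with ℕ.<-≤-connex j k
      ... | inj₁ j<k = begin
        M₁ f 0 j                                             ≡⟨ ext₁-top-outside f j (inj₁ j<k) ⟩
        0#                                                   ≈⟨ zero-combination _ _ ⟩
        f 0 0 ⊛ 0# ⊕ f 0 1 ⊛ 0#                              ≡⟨ ≡.cong₂ (λ x y → f 0 0 ⊛ x ⊕ f 0 1 ⊛ y)
                                                                  (≡.sym (ext₁-top-outside _ j (inj₁ j<k)))
                                                                  (≡.sym (ext₁-top-outside _ j (inj₁ j<k))) ⟩
        f 0 0 ⊛ M₁ (λ _ → δ 0) 0 j ⊕ f 0 1 ⊛ M₁ (λ _ → δ 1) 0 j ∎
      ... | inj₂ k≤j = begin
        M₁ f 0 j                                             ≡⟨ ext₁-top-inside f j k≤j (<k+2 j<2+k) ⟩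
        f 0 (j ∸ k)                                          ≈⟨ expand-δ (f 0) (j ∸ k) (ℕ.m<n+o⇒m∸n<o j k (<k+2 j<2+k)) ⟩
        f 0 0 ⊛ δ 0 (j ∸ k) ⊕ f 0 1 ⊛ δ 1 (j ∸ k)            ≡⟨ ≡.cong₂ (λ x y → f 0 0 ⊛ x ⊕ f 0 1 ⊛ y)
                                                                  (≡.sym (ext₁-top-inside _ j k≤j (<k+2 j<2+k)))
                                                                  (≡.sym (ext₁-top-inside _ j k≤j (<k+2 j<2+k))) ⟩
        f 0 0 ⊛ M₁ (λ _ → δ 0) 0 j ⊕ f 0 1 ⊛ M₁ (λ _ → δ 1) 0 j ∎

    ext₂-expand : ∀ b d → signedDet (3 + k) (matrixOf (ps ++ ext₂ b d) (3 + k)) ≈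
      d 1 0 ⊛ signedDet (2 + k) (matrixOf (ps ++ ext₁ (λ _ → b 0)) (2 + k))
      ⊝ d 0 0 ⊛ signedDet (2 + k) (matrixOf (ps ++ ext₁ (λ _ → b 1)) (2 + k))
    ext₂-expand b d = begin
      negPow (signExp (3 + k)) ⊛ (sumTo (2 + k) (laplaceTerm (2 + k) M) ⊕ laplaceTerm (2 + k) M (2 + k))
        ≈⟨ *-cong (negPow-signExp-suc k) (+-cong init last) ⟩
      (negPow (signExp (2 + k)) ⊛ negPow (suc k))
        ⊛ ((negPow (suc k) ⊛ d 1 0) ⊛ det (2 + k) N₀ ⊕ (⊖ negPow (suc k)) ⊛ (d 0 0 ⊛ det (2 + k) N₁))
        ≈⟨ resign _ _ _ _ _ _ (negPow-square (suc k)) ⟩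
      d 1 0 ⊛ signedDet (2 + k) N₀ ⊝ d 0 0 ⊛ signedDet (2 + k) N₁ ∎
      where
      M N₀ N₁ : Matrix
      M  = matrixOf (ps ++ ext₂ b d) (3 + k)
      N₀ = matrixOf (ps ++ ext₁ (λ _ → b 0)) (2 + k)
      N₁ = matrixOf (ps ++ ext₁ (λ _ → b 1)) (2 + k)

      lower-N : ∀ r i l → M (2 + i) l ≡ matrixOf (ps ++ ext₁ (λ _ → b r)) (2 + k) (suc i) l
      lower-N r i l = ≡.trans (ext₂-lower b d i l) (≡.sym (ext₁-lower _ i l))

      -- for j < 2 + k the minor of M at (0, j) has in its last column only d 1 0
      init : sumTo (2 + k) (laplaceTerm (2 + k) M) ≈ (negPow (suc k) ⊛ d 1 0) ⊛ det (2 + k) N₀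
      init = sumTo-*ˡ (2 + k) _ λ j j<2+k →
        let lastCol≈0 : ∀ i → 0 < i → i < 2 + k → minor j M i (suc k) ≈ 0#
            lastCol≈0 = λ { zero () _
                          ; (suc i) _ _ → reflexive (≡.trans (≡.cong (M (2 + i)) (skip-≥ (ℕ.≤-pred j<2+k)))
                                                   (≡.trans (ext₂-lower b d i (2 + k)) (ps-beyondWidth (k ∸ i)))) }
            corner : minor j M 0 (suc k) ≡ d 1 0
            corner = ≡.trans (≡.cong (M 1) (skip-≥ (ℕ.≤-pred j<2+k))) (ext₂-lastCol b d 1 (s≤s (s≤s z≤n)))
            rest : ∀ i l → i < suc k → l < suc k → minor (suc k) (minor j M) i l ≈ minor j N₀ i l
            rest i l _ l<1+k = reflexive (≡.trans (≡.cong (λ t → M (2 + i) (skip j t)) (skip-< l<1+k)) (lower-N 0 i _))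
        in begin
        negPow j ⊛ (M 0 j ⊛ det (2 + k) (minor j M))
          ≈⟨ *-congˡ (*-cong (reflexive (ext₂-upperRows b d 0 j (s≤s z≤n) j<2+k)) (det-lastCol-top (suc k) (minor j M) lastCol≈0)) ⟩
        negPow j ⊛ (N₀ 0 j ⊛ (negPow (suc k) ⊛ (minor j M 0 (suc k) ⊛ det (suc k) (minor (suc k) (minor j M)))))
          ≈⟨ *-congˡ (*-congˡ (*-congˡ (*-cong (reflexive corner) (det-cong (suc k) rest)))) ⟩
        negPow j ⊛ (N₀ 0 j ⊛ (negPow (suc k) ⊛ (d 1 0 ⊛ det (suc k) (minor j N₀))))
          ≈⟨ solve 5 (λ a x s y D → a :* (x :* (s :* (y :* D))) := (s :* y) :* (a :* (x :* D))) refl _ _ _ _ _ ⟩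
        (negPow (suc k) ⊛ d 1 0) ⊛ laplaceTerm (suc k) N₀ j ∎

      last : laplaceTerm (2 + k) M (2 + k) ≈ (⊖ negPow (suc k)) ⊛ (d 0 0 ⊛ det (2 + k) N₁)
      last = *-congˡ (*-cong (reflexive (ext₂-lastCol b d 0 (s≤s z≤n))) (det-cong (2 + k) minor≈N₁))
        where
        minor≈N₁ : ∀ i l → i < 2 + k → l < 2 + k → minor (2 + k) M i l ≈ N₁ i l
        minor≈N₁ zero    l _ l<2+k = reflexive (≡.trans (≡.cong (M 1) (skip-< l<2+k)) (ext₂-upperRows b d 1 l (s≤s (s≤s z≤n)) l<2+k))
        minor≈N₁ (suc i) l _ l<2+k = reflexive (≡.trans (≡.cong (M (2 + i)) (skip-< l<2+k)) (lower-N 1 i l))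

  -- Here `ps` fills rows ≤ 1 + k and columns ≤ k, and the next piece goes to
  -- the right of its last one, at (k, 1 + k).
  module Beside (ps : List Placed) (k : ℕ) (height : heightOf ps ≡ 2 + k) (width : widthOf ps ≡ suc k) where
    ext₁ : Matrix → List Placed
    ext₁ e = (k , suc k , vdom e) ∷ []

    hdomAbove : Matrix → List Placed
    hdomAbove d = (k + 2 , suc k , hdom d) ∷ []

    ext₂ : Matrix → Matrix → List Placed
    ext₂ b d = (k , suc k , block b) ∷ hdomAbove d

    private
      above-ps : ∀ {Y} → 2 + k ≤ Y → heightOf ps ≤ Y
      above-ps {Y} = ≡.subst (_≤ Y) (≡.sym height)

      right-of-ps : ∀ {j} → suc k ≤ j → widthOf ps ≤ j
      right-of-ps {j} = ≡.subst (_≤ j) (≡.sym width)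

      below-top : ∀ i → suc k ∸ i < k + 2
      below-top i = <k+2 (s≤s (ℕ.m∸n≤m (suc k) i))

      inRightCols : ∀ {j} → j < 2 → j + suc k < suc k + 2
      inRightCols {j} j<2 = ≡.subst (j + suc k <_) (ℕ.+-comm 2 (suc k)) (ℕ.+-monoˡ-< (suc k) j<2)

    ext₁-left : ∀ e i j → j < suc k → matrixOf (ps ++ ext₁ e) (2 + k) i j ≡ cellAt ps (suc k ∸ i) j
    ext₁-left e i j j<1+k = cellAt-++-vacant ps (ext₁ e) (suc k ∸ i) j
      (cellAt-outside k (suc k) (vdom e) [] (suc k ∸ i) j (leftOf j<1+k))

    ext₂-left : ∀ b d i j → j < suc k → matrixOf (ps ++ ext₂ b d) (3 + k) (suc i) j ≡ cellAt ps (suc k ∸ i) j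
    ext₂-left b d i j j<1+k = cellAt-++-vacant ps (ext₂ b d) (suc k ∸ i) j
      (≡.trans (cellAt-outside k (suc k) (block b) (hdomAbove d) (suc k ∸ i) j (leftOf j<1+k))
               (cellAt-outside (k + 2) (suc k) (hdom d) [] (suc k ∸ i) j (leftOf j<1+k)))

    ext₂-top-left : ∀ b d j → j < suc k → matrixOf (ps ++ ext₂ b d) (3 + k) 0 j ≡ 0#
    ext₂-top-left b d j j<1+k = ≡.trans (cellAt-++-above ps (ext₂ b d) (2 + k) j (above-ps ℕ.≤-refl))
      (≡.trans (cellAt-outside k (suc k) (block b) (hdomAbove d) (2 + k) j (over (ℕ.≤-reflexive (k+2≡2+k k))))
               (cellAt-outside (k + 2) (suc k) (hdom d) [] (2 + k) j (leftOf j<1+k)))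

    ext₂-top-right : ∀ b d j → j < 2 → matrixOf (ps ++ ext₂ b d) (3 + k) 0 (j + suc k) ≡ d 0 j
    ext₂-top-right b d j j<2 = ≡.trans (cellAt-++-above ps (ext₂ b d) (2 + k) (j + suc k) (above-ps ℕ.≤-refl))
      (≡.trans (cellAt-outside k (suc k) (block b) (hdomAbove d) (2 + k) (j + suc k) (over (ℕ.≤-reflexive (k+2≡2+k k))))
      (≡.trans (cellAt-inside (k + 2) (suc k) (hdom d) [] (2 + k) (j + suc k) (ℕ.≤-reflexive (k+2≡2+k k))
                              (≡.subst (2 + k <_) (≡.sym (≡.trans (ℕ.+-comm (k + 2) 1) (≡.cong suc (k+2≡2+k k)))) ℕ.≤-refl)
                              (ℕ.m≤n+m (suc k) j) (inRightCols j<2))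
               (≡.cong₂ (λ t u → d (1 ∸ suc t) u) (2+k∸k+2≡0 k) (ℕ.m+n∸n≡m j (suc k)))))

    ext₁-lastCol-inside : ∀ e i → k ≤ suc k ∸ i →
      matrixOf (ps ++ ext₁ e) (2 + k) i (suc k) ≡ e (2 ∸ suc (suc k ∸ i ∸ k)) 0
    ext₁-lastCol-inside e i k≤Y = ≡.trans (cellAt-++-right ps (ext₁ e) (suc k ∸ i) (suc k) (right-of-ps ℕ.≤-refl))
      (≡.trans (cellAt-inside k (suc k) (vdom e) [] (suc k ∸ i) (suc k) k≤Y (below-top i) ℕ.≤-refl
                              (≡.subst (suc k <_) (≡.sym (ℕ.+-comm (suc k) 1)) ℕ.≤-refl))
               (≡.cong (e _) (ℕ.n∸n≡0 (suc k))))

    ext₁-lastCol-outside : ∀ e i → suc k ∸ i < k → matrixOf (ps ++ ext₁ e) (2 + k) i (suc k) ≡ 0#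
    ext₁-lastCol-outside e i Y<k = ≡.trans (cellAt-++-right ps (ext₁ e) (suc k ∸ i) (suc k) (right-of-ps ℕ.≤-refl))
      (cellAt-outside k (suc k) (vdom e) [] (suc k ∸ i) (suc k) (under Y<k))

    ext₂-rightCols : ∀ b d i j → j < 2 →
      matrixOf (ps ++ ext₂ b d) (3 + k) (suc i) (j + suc k) ≡ matrixOf (ps ++ ext₁ (λ i _ → b i j)) (2 + k) i (suc k)
    ext₂-rightCols b d i j j<2 with ℕ.<-≤-connex (suc k ∸ i) k
    ... | inj₂ k≤Y = ≡.trans (cellAt-++-right ps (ext₂ b d) (suc k ∸ i) (j + suc k) (right-of-ps (ℕ.m≤n+m (suc k) j)))
          (≡.trans (cellAt-inside k (suc k) (block b) (hdomAbove d) (suc k ∸ i) (j + suc k) k≤Y (below-top i)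
                                  (ℕ.m≤n+m (suc k) j) (inRightCols j<2))
          (≡.trans (≡.cong (b _) (ℕ.m+n∸n≡m j (suc k)))
                   (≡.sym (ext₁-lastCol-inside (λ i _ → b i j) i k≤Y))))
    ... | inj₁ Y<k = ≡.trans (cellAt-++-right ps (ext₂ b d) (suc k ∸ i) (j + suc k) (right-of-ps (ℕ.m≤n+m (suc k) j)))
          (≡.trans (cellAt-outside k (suc k) (block b) (hdomAbove d) (suc k ∸ i) (j + suc k) (under Y<k))
          (≡.trans (cellAt-outside (k + 2) (suc k) (hdom d) [] (suc k ∸ i) (j + suc k) (under (ℕ.<-≤-trans Y<k (ℕ.m≤m+n k 2))))
                   (≡.sym (ext₁-lastCol-outside _ i Y<k))))

    ext₁-linear : ∀ e → signedDet (2 + k) (matrixOf (ps ++ ext₁ e) (2 + k)) ≈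
      e 0 0 ⊛ signedDet (2 + k) (matrixOf (ps ++ ext₁ (λ i _ → δ 0 i)) (2 + k))
      ⊕ e 1 0 ⊛ signedDet (2 + k) (matrixOf (ps ++ ext₁ (λ i _ → δ 1 i)) (2 + k))
    ext₁-linear e = trans (*-congˡ (det-lastCol-linear (suc k) (M₁ e) (M₁ (λ i _ → δ 0 i)) (M₁ (λ i _ → δ 1 i)) (e 0 0) (e 1 0)
                                      lastCol (λ i j _ j<1+k → same-left i j 0 j<1+k) (λ i j _ j<1+k → same-left i j 1 j<1+k)))
                          (solve 5 (λ g a b x y → g :* (a :* x :+ b :* y) := a :* (g :* x) :+ b :* (g :* y)) refl _ _ _ _ _)
      where
      M₁ : Matrix → Matrix
      M₁ e = matrixOf (ps ++ ext₁ e) (2 + k)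
      same-left : ∀ i j t → j < suc k → M₁ e i j ≈ M₁ (λ i _ → δ t i) i j
      same-left i j t j<1+k = reflexive (≡.trans (ext₁-left e i j j<1+k) (≡.sym (ext₁-left _ i j j<1+k)))
      lastCol : ∀ i → i < 2 + k → M₁ e i (suc k) ≈ e 0 0 ⊛ M₁ (λ i _ → δ 0 i) i (suc k) ⊕ e 1 0 ⊛ M₁ (λ i _ → δ 1 i) i (suc k)
      lastCol i _ with ℕ.<-≤-connex (suc k ∸ i) k
      ... | inj₁ Y<k = begin
        M₁ e i (suc k)                                      ≡⟨ ext₁-lastCol-outside e i Y<k ⟩
        0#                                                  ≈⟨ zero-combination _ _ ⟩
        e 0 0 ⊛ 0# ⊕ e 1 0 ⊛ 0#                             ≡⟨ ≡.cong₂ (λ x y → e 0 0 ⊛ x ⊕ e 1 0 ⊛ y)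
                                                                 (≡.sym (ext₁-lastCol-outside _ i Y<k))
                                                                 (≡.sym (ext₁-lastCol-outside _ i Y<k)) ⟩
        e 0 0 ⊛ M₁ (λ i _ → δ 0 i) i (suc k) ⊕ e 1 0 ⊛ M₁ (λ i _ → δ 1 i) i (suc k) ∎
      ... | inj₂ k≤Y = begin
        M₁ e i (suc k)                                      ≡⟨ ext₁-lastCol-inside e i k≤Y ⟩
        e (1 ∸ (suc k ∸ i ∸ k)) 0                           ≈⟨ expand-δ (λ m → e m 0) m (s≤s (ℕ.m∸n≤m 1 (suc k ∸ i ∸ k))) ⟩
        e 0 0 ⊛ δ 0 m ⊕ e 1 0 ⊛ δ 1 m                       ≡⟨ ≡.cong₂ (λ x y → e 0 0 ⊛ x ⊕ e 1 0 ⊛ y)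
                                                                 (≡.sym (ext₁-lastCol-inside _ i k≤Y))
                                                                 (≡.sym (ext₁-lastCol-inside _ i k≤Y)) ⟩
        e 0 0 ⊛ M₁ (λ i _ → δ 0 i) i (suc k) ⊕ e 1 0 ⊛ M₁ (λ i _ → δ 1 i) i (suc k) ∎
        where m = 1 ∸ (suc k ∸ i ∸ k)

    ext₂-expand : ∀ b d → signedDet (3 + k) (matrixOf (ps ++ ext₂ b d) (3 + k)) ≈
      d 0 0 ⊛ signedDet (2 + k) (matrixOf (ps ++ ext₁ (λ i _ → b i 1)) (2 + k))
      ⊝ d 0 1 ⊛ signedDet (2 + k) (matrixOf (ps ++ ext₁ (λ i _ → b i 0)) (2 + k))
    ext₂-expand b d = begin
      negPow (signExp (3 + k)) ⊛ ((sumTo (suc k) (laplaceTerm (2 + k) M) ⊕ laplaceTerm (2 + k) M (suc k))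
                                   ⊕ laplaceTerm (2 + k) M (2 + k))
        ≈⟨ *-cong (negPow-signExp-suc k) (+-cong first last) ⟩
      (negPow (signExp (2 + k)) ⊛ negPow (suc k))
        ⊛ ((negPow (suc k) ⊛ d 0 0) ⊛ det (2 + k) (Ext 1) ⊕ (⊖ negPow (suc k)) ⊛ (d 0 1 ⊛ det (2 + k) (Ext 0)))
        ≈⟨ resign _ _ _ _ _ _ (negPow-square (suc k)) ⟩
      d 0 0 ⊛ signedDet (2 + k) (Ext 1) ⊝ d 0 1 ⊛ signedDet (2 + k) (Ext 0) ∎
      where
      M : Matrix
      M = matrixOf (ps ++ ext₂ b d) (3 + k)
      Ext : ℕ → Matrix
      Ext t = matrixOf (ps ++ ext₁ (λ i _ → b i t)) (2 + k)

      left : ∀ t i l → l < suc k → M (suc i) l ≡ Ext t i l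
      left t i l l<1+k = ≡.trans (ext₂-left b d i l l<1+k) (≡.sym (ext₁-left _ i l l<1+k))

      first : sumTo (suc k) (laplaceTerm (2 + k) M) ⊕ laplaceTerm (2 + k) M (suc k) ≈ (negPow (suc k) ⊛ d 0 0) ⊛ det (2 + k) (Ext 1)
      first = begin
        sumTo (suc k) (laplaceTerm (2 + k) M) ⊕ laplaceTerm (2 + k) M (suc k)
          ≈⟨ +-cong (sumTo-≈0 (suc k) λ j j<1+k → laplaceTerm-entry≈0 (2 + k) M j (reflexive (ext₂-top-left b d j j<1+k)))
                    (*-congˡ (*-cong (reflexive (ext₂-top-right b d 0 (s≤s z≤n))) (det-cong (2 + k) minor≈N₁))) ⟩
        0# ⊕ negPow (suc k) ⊛ (d 0 0 ⊛ det (2 + k) (Ext 1))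
          ≈⟨ trans (+-identityˡ _) (sym (*-assoc _ _ _)) ⟩
        (negPow (suc k) ⊛ d 0 0) ⊛ det (2 + k) (Ext 1) ∎
        where
        minor≈N₁ : ∀ i l → i < 2 + k → l < 2 + k → minor (suc k) M i l ≈ Ext 1 i l
        minor≈N₁ i l _ l<2+k with ℕ.m<1+n⇒m<n∨m≡n l<2+k
        ... | inj₁ l<1+k  = reflexive (≡.trans (≡.cong (M (suc i)) (skip-< l<1+k)) (left 1 i l l<1+k))
        ... | inj₂ ≡.refl = reflexive (≡.trans (≡.cong (M (suc i)) (skip-≥ {suc k} ℕ.≤-refl))
                                               (ext₂-rightCols b d i 1 (s≤s (s≤s z≤n))))

      last : laplaceTerm (2 + k) M (2 + k) ≈ (⊖ negPow (suc k)) ⊛ (d 0 1 ⊛ det (2 + k) (Ext 0))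
      last = *-congˡ (*-cong (reflexive (ext₂-top-right b d 1 (s≤s (s≤s z≤n)))) (det-cong (2 + k) minor≈N₀))
        where
        minor≈N₀ : ∀ i l → i < 2 + k → l < 2 + k → minor (2 + k) M i l ≈ Ext 0 i l
        minor≈N₀ i l _ l<2+k with ℕ.m<1+n⇒m<n∨m≡n l<2+k
        ... | inj₁ l<1+k  = reflexive (≡.trans (≡.cong (M (suc i)) (skip-< l<2+k)) (left 0 i l l<1+k))
        ... | inj₂ ≡.refl = reflexive (≡.trans (≡.cong (M (suc i)) (skip-< l<2+k))
                                               (ext₂-rightCols b d i 0 (s≤s z≤n)))

module Transfer {c ℓ} (R : CommutativeRing c ℓ) where
  open CommutativeRing R renaming (_+_ to _⊕_; _*_ to _⊛_; -_ to ⊖_; _-_ to _⊝_)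
  open WithRing R
  open Determinant R
  open Layout R
  open Staircase R
  open SetoidReasoning setoid

  signedDetOf : List Piece → Carrier
  signedDetOf Xs = signedDet (drhRows Xs) (drhMat Xs)

  origin : Piece → Slot
  origin X₀ = ((rows X₀ ≤ᵇ 1) , 0 , 0)

  laid : Piece → List Piece → List Placed
  laid X₀ Xs = layoutFrom (origin X₀) (X₀ ∷ Xs)

  slot : Piece → List Piece → Slot
  slot X₀ Xs = slotAfter (origin X₀) (X₀ ∷ Xs)

  laid-++ : ∀ X₀ Xs Ys → laid X₀ (Xs ++ Ys) ≡ laid X₀ Xs ++ layoutFrom (slot X₀ Xs) Ys
  laid-++ X₀ Xs Ys = layoutFrom-++ (origin X₀) (X₀ ∷ Xs) Ys

  laid-++-at : ∀ X₀ Xs Ys {s} → slot X₀ Xs ≡ s → laid X₀ (Xs ++ Ys) ≡ laid X₀ Xs ++ layoutFrom s Ys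
  laid-++-at X₀ Xs Ys slot≡s = ≡.trans (laid-++ X₀ Xs Ys) (≡.cong (λ s → laid X₀ Xs ++ layoutFrom s Ys) slot≡s)

  signedDetOf-extend : ∀ X₀ Xs Ys {s n} → slot X₀ Xs ≡ s → heightOf (laid X₀ Xs ++ layoutFrom s Ys) ≡ n →
    signedDetOf (X₀ ∷ (Xs ++ Ys)) ≡ signedDet n (matrixOf (laid X₀ Xs ++ layoutFrom s Ys) n)
  signedDetOf-extend X₀ Xs Ys {s} slot≡s height =
    ≡.trans (≡.cong signedDetAt (laid-++-at X₀ Xs Ys slot≡s)) (signedDetAt-height (laid X₀ Xs ++ layoutFrom s Ys) height)
    where
    signedDetAt : List Placed → Carrier
    signedDetAt ps = signedDet (heightOf ps) (matrixOf ps (heightOf ps))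
    signedDetAt-height : ∀ ps {n} → heightOf ps ≡ n → signedDetAt ps ≡ signedDet n (matrixOf ps n)
    signedDetAt-height ps ≡.refl = ≡.refl

  nextSlot : Dir → ℕ → Slot
  nextSlot N k = (false , suc k , k)
  nextSlot E k = (true , k , suc k)

  heightAt widthAt : Dir → ℕ → ℕ
  heightAt N k = suc k
  heightAt E k = 2 + k
  widthAt N k = 2 + k
  widthAt E k = suc k

  -- After X₀ and k blocks the pieces form a staircase; the direction d is the
  -- step of the lattice path at the current index (N: the next piece goes on
  -- top, E: it goes to the right).
  record IsStaircase (d : Dir) (X₀ : Piece) (Xs : List Piece) (k : ℕ) : Set where
    field
      slot-≡   : slot X₀ Xs ≡ nextSlot d k
      height-≡ : heightOf (laid X₀ Xs) ≡ heightAt d k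
      width-≡  : widthOf (laid X₀ Xs) ≡ widthAt d k

  domino : Dir → Matrix → Piece
  domino N = hdom
  domino E = vdom

  unit : Dir → ℕ → Matrix
  unit N t _ j = δ t j
  unit E t i _ = δ t i

  coords : Dir → Matrix → Carrier × Carrier
  coords N f = (f 0 0 , f 0 1)
  coords E f = (f 0 0 , f 1 0)

  dot : Carrier × Carrier → Carrier × Carrier → Carrier
  dot (p , q) (u , v) = p ⊛ u ⊕ q ⊛ v

  closing : Piece → List Piece → Piece → Carrier
  closing X₀ Xs Y = signedDetOf (X₀ ∷ (Xs ++ Y ∷ []))

  closing-block : ∀ X₀ Xs b Y → closing X₀ (Xs ++ block b ∷ []) Y ≡ signedDetOf (X₀ ∷ (Xs ++ block b ∷ Y ∷ []))
  closing-block X₀ Xs b Y = ≡.cong (λ L → signedDetOf (X₀ ∷ L)) (List.++-assoc Xs (block b ∷ []) (Y ∷ []))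

  prefixVector : Dir → Piece → List Piece → Carrier × Carrier
  prefixVector d X₀ Xs = (closing X₀ Xs (domino d (unit d 0)) , closing X₀ Xs (domino d (unit d 1)))

  module GrowN {X₀ Xs k} (S : IsStaircase N X₀ Xs k) where
    open IsStaircase S

    open Atop (laid X₀ Xs) k height-≡ width-≡

    private
      1+k+2≡3+k : suc k + 2 ≡ 3 + k
      1+k+2≡3+k = ℕ.+-comm (suc k) 2

      1+k⊔[3+k] : suc k ⊔ (3 + k) ≡ 3 + k
      1+k⊔[3+k] = ℕ.m≤n⇒m⊔n≡n (ℕ.m≤n+m (suc k) 2)

    M₁ : Matrix → Matrix
    M₁ f = matrixOf (laid X₀ Xs ++ ext₁ f) (2 + k)

    extend₁ : ∀ f → closing X₀ Xs (hdom f) ≡ signedDet (2 + k) (M₁ f)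
    extend₁ f = signedDetOf-extend X₀ Xs (hdom f ∷ []) slot-≡
      (heightOf-++-≡ (laid X₀ Xs) (ext₁ f) height-≡ (ℕ.+-comm (suc k) 1) (ℕ.m≤n⇒m⊔n≡n (ℕ.n≤1+n _)))

    extend₂ : ∀ b d → closing X₀ (Xs ++ block b ∷ []) (vdom d) ≡
                      signedDet (3 + k) (matrixOf (laid X₀ Xs ++ ext₂ b d) (3 + k))
    extend₂ b d = ≡.trans (closing-block X₀ Xs b (vdom d)) (signedDetOf-extend X₀ Xs (block b ∷ vdom d ∷ []) slot-≡
      (heightOf-++-≡ (laid X₀ Xs) (ext₂ b d) height-≡
        (≡.trans (≡.cong (λ t → t ⊔ t) 1+k+2≡3+k) (ℕ.⊔-idem (3 + k))) 1+k⊔[3+k]))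

    domino-linear : ∀ f → closing X₀ Xs (hdom f) ≈ dot (coords N f) (prefixVector N X₀ Xs)
    domino-linear f = begin
      closing X₀ Xs (hdom f)
        ≡⟨ extend₁ f ⟩
      signedDet (2 + k) (M₁ f)
        ≈⟨ ext₁-linear f ⟩
      f 0 0 ⊛ signedDet (2 + k) (M₁ (unit N 0)) ⊕ f 0 1 ⊛ signedDet (2 + k) (M₁ (unit N 1))
        ≡⟨ ≡.cong₂ (λ u v → f 0 0 ⊛ u ⊕ f 0 1 ⊛ v) (≡.sym (extend₁ _)) (≡.sym (extend₁ _)) ⟩
      dot (coords N f) (prefixVector N X₀ Xs) ∎

    block-expand : ∀ b d → closing X₀ (Xs ++ block b ∷ []) (vdom d) ≈
      d 1 0 ⊛ closing X₀ Xs (hdom (λ _ → b 0)) ⊝ d 0 0 ⊛ closing X₀ Xs (hdom (λ _ → b 1))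
    block-expand b d = begin
      closing X₀ (Xs ++ block b ∷ []) (vdom d)
        ≡⟨ extend₂ b d ⟩
      signedDet (3 + k) (matrixOf (laid X₀ Xs ++ ext₂ b d) (3 + k))
        ≈⟨ ext₂-expand b d ⟩
      d 1 0 ⊛ signedDet (2 + k) (M₁ (λ _ → b 0)) ⊝ d 0 0 ⊛ signedDet (2 + k) (M₁ (λ _ → b 1))
        ≡⟨ ≡.cong₂ (λ u v → d 1 0 ⊛ u ⊝ d 0 0 ⊛ v) (≡.sym (extend₁ _)) (≡.sym (extend₁ _)) ⟩
      d 1 0 ⊛ closing X₀ Xs (hdom (λ _ → b 0)) ⊝ d 0 0 ⊛ closing X₀ Xs (hdom (λ _ → b 1)) ∎

    block-shape : ∀ b → IsStaircase E X₀ (Xs ++ block b ∷ []) (suc k)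
    block-shape b = record
      { slot-≡   = ≡.trans (slotAfter-++ (origin X₀) (X₀ ∷ Xs) (block b ∷ []))
                  (≡.trans (≡.cong (λ s → slotAfter s (block b ∷ [])) slot-≡)
                           (≡.cong (λ t → true , suc k , t) (ℕ.+-comm k 2)))
      ; height-≡ = ≡.trans (≡.cong heightOf (laid-++-at X₀ Xs (block b ∷ []) slot-≡))
                           (heightOf-++-≡ (laid X₀ Xs) _ height-≡ (≡.trans (ℕ.⊔-identityʳ _) 1+k+2≡3+k) 1+k⊔[3+k])
      ; width-≡  = ≡.trans (≡.cong widthOf (laid-++-at X₀ Xs (block b ∷ []) slot-≡))
                           (widthOf-++-≡ (laid X₀ Xs) _ width-≡ (≡.trans (ℕ.⊔-identityʳ _) (ℕ.+-comm k 2)) (ℕ.⊔-idem (2 + k)))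
      }

  module GrowE {X₀ Xs k} (S : IsStaircase E X₀ Xs k) where
    open IsStaircase S

    open Beside (laid X₀ Xs) k height-≡ width-≡

    private
      k+2⊔0≡2+k : (k + 2) ⊔ 0 ≡ 2 + k
      k+2⊔0≡2+k = ≡.trans (ℕ.⊔-identityʳ _) (ℕ.+-comm k 2)

      m⊔1+m : ∀ m → m ⊔ suc m ≡ suc m
      m⊔1+m m = ℕ.m≤n⇒m⊔n≡n (ℕ.n≤1+n m)

    M₁ : Matrix → Matrix
    M₁ e = matrixOf (laid X₀ Xs ++ ext₁ e) (2 + k)

    extend₁ : ∀ e → closing X₀ Xs (vdom e) ≡ signedDet (2 + k) (M₁ e)
    extend₁ e = signedDetOf-extend X₀ Xs (vdom e ∷ []) slot-≡
      (heightOf-++-≡ (laid X₀ Xs) (ext₁ e) height-≡ k+2⊔0≡2+k (ℕ.⊔-idem (2 + k)))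

    extend₂ : ∀ b d → closing X₀ (Xs ++ block b ∷ []) (hdom d) ≡
                      signedDet (3 + k) (matrixOf (laid X₀ Xs ++ ext₂ b d) (3 + k))
    extend₂ b d = ≡.trans (closing-block X₀ Xs b (hdom d)) (signedDetOf-extend X₀ Xs (block b ∷ hdom d ∷ []) slot-≡
      (heightOf-++-≡ (laid X₀ Xs) (ext₂ b d) height-≡ ext₂-height (m⊔1+m (2 + k))))
      where
      ext₂-height : (k + 2) ⊔ ((k + 2 + 1) ⊔ 0) ≡ 3 + k
      ext₂-height = ≡.trans (≡.cong (λ t → t ⊔ ((t + 1) ⊔ 0)) (ℕ.+-comm k 2))
                    (≡.trans (≡.cong ((2 + k) ⊔_) (ℕ.+-comm (2 + k) 1)) (m⊔1+m (2 + k)))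

    domino-linear : ∀ e → closing X₀ Xs (vdom e) ≈ dot (coords E e) (prefixVector E X₀ Xs)
    domino-linear e = begin
      closing X₀ Xs (vdom e)
        ≡⟨ extend₁ e ⟩
      signedDet (2 + k) (M₁ e)
        ≈⟨ ext₁-linear e ⟩
      e 0 0 ⊛ signedDet (2 + k) (M₁ (unit E 0)) ⊕ e 1 0 ⊛ signedDet (2 + k) (M₁ (unit E 1))
        ≡⟨ ≡.cong₂ (λ u v → e 0 0 ⊛ u ⊕ e 1 0 ⊛ v) (≡.sym (extend₁ _)) (≡.sym (extend₁ _)) ⟩
      dot (coords E e) (prefixVector E X₀ Xs) ∎

    block-expand : ∀ b d → closing X₀ (Xs ++ block b ∷ []) (hdom d) ≈
      d 0 0 ⊛ closing X₀ Xs (vdom (λ i _ → b i 1)) ⊝ d 0 1 ⊛ closing X₀ Xs (vdom (λ i _ → b i 0))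
    block-expand b d = begin
      closing X₀ (Xs ++ block b ∷ []) (hdom d)
        ≡⟨ extend₂ b d ⟩
      signedDet (3 + k) (matrixOf (laid X₀ Xs ++ ext₂ b d) (3 + k))
        ≈⟨ ext₂-expand b d ⟩
      d 0 0 ⊛ signedDet (2 + k) (M₁ (λ i _ → b i 1)) ⊝ d 0 1 ⊛ signedDet (2 + k) (M₁ (λ i _ → b i 0))
        ≡⟨ ≡.cong₂ (λ u v → d 0 0 ⊛ u ⊝ d 0 1 ⊛ v) (≡.sym (extend₁ _)) (≡.sym (extend₁ _)) ⟩
      d 0 0 ⊛ closing X₀ Xs (vdom (λ i _ → b i 1)) ⊝ d 0 1 ⊛ closing X₀ Xs (vdom (λ i _ → b i 0)) ∎

    block-shape : ∀ b → IsStaircase N X₀ (Xs ++ block b ∷ []) (suc k)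
    block-shape b = record
      { slot-≡   = ≡.trans (slotAfter-++ (origin X₀) (X₀ ∷ Xs) (block b ∷ []))
                  (≡.trans (≡.cong (λ s → slotAfter s (block b ∷ [])) slot-≡)
                           (≡.cong (λ t → false , t , suc k) (ℕ.+-comm k 2)))
      ; height-≡ = ≡.trans (≡.cong heightOf (laid-++-at X₀ Xs (block b ∷ []) slot-≡))
                           (heightOf-++-≡ (laid X₀ Xs) _ height-≡ k+2⊔0≡2+k (ℕ.⊔-idem (2 + k)))
      ; width-≡  = ≡.trans (≡.cong widthOf (laid-++-at X₀ Xs (block b ∷ []) slot-≡))
                           (widthOf-++-≡ (laid X₀ Xs) _ width-≡ (≡.trans (ℕ.⊔-identityʳ _) (ℕ.+-comm (suc k) 2))
                                         (ℕ.m≤n⇒m⊔n≡n (ℕ.m≤n+m (suc k) 2)))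
      }

  throughBlock : Dir → Matrix → Carrier × Carrier → Carrier × Carrier
  throughBlock N b (p , q) = (q ⊛ b 0 0 ⊝ p ⊛ b 1 0 , q ⊛ b 0 1 ⊝ p ⊛ b 1 1)
  throughBlock E b (p , q) = (p ⊛ b 0 1 ⊝ q ⊛ b 0 0 , p ⊛ b 1 1 ⊝ q ⊛ b 1 0)

  throughBlocks : Dir → List Matrix → Carrier × Carrier → Carrier × Carrier
  throughBlocks d []       v = v
  throughBlocks d (b ∷ bs) v = throughBlock d b (throughBlocks (turn d) bs v)

  block-shape : ∀ {d X₀ Xs k} → IsStaircase d X₀ Xs k → ∀ b → IsStaircase (turn d) X₀ (Xs ++ block b ∷ []) (suc k)
  block-shape {N} S = GrowN.block-shape S
  block-shape {E} S = GrowE.block-shape S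

  domino-linear : ∀ {d X₀ Xs k} → IsStaircase d X₀ Xs k →
    ∀ f → signedDetOf (X₀ ∷ (Xs ++ domino d f ∷ [])) ≈ dot (coords d f) (prefixVector d X₀ Xs)
  domino-linear {N} S = GrowN.domino-linear S
  domino-linear {E} S = GrowE.domino-linear S

  private
    0x-1y≈-y : ∀ x y → 0# ⊛ x ⊝ 1# ⊛ y ≈ ⊖ y
    0x-1y≈-y x y = trans (+-cong (zeroˡ x) (-‿cong (*-identityˡ y))) (+-identityˡ _)

    1x-0y≈x : ∀ x y → 1# ⊛ x ⊝ 0# ⊛ y ≈ x
    1x-0y≈x x y = trans (+-cong (*-identityˡ x) (trans (-‿cong (zeroˡ y)) (solve 0 (:- con (ℤ.+ 0) := con (ℤ.+ 0)) refl)))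
                        (+-identityʳ x)

  prefixVector-block : ∀ {d X₀ Xs k} → IsStaircase d X₀ Xs k → ∀ b v →
    dot v (prefixVector (turn d) X₀ (Xs ++ block b ∷ [])) ≈ dot (throughBlock d b v) (prefixVector d X₀ Xs)
  prefixVector-block {N} {X₀} {Xs} S b (p , q) = begin
    p ⊛ closing X₀ (Xs ++ block b ∷ []) (vdom (unit E 0)) ⊕ q ⊛ closing X₀ (Xs ++ block b ∷ []) (vdom (unit E 1))
      ≈⟨ +-cong (*-congˡ (trans (GrowN.block-expand S b _) (0x-1y≈-y _ _)))
                (*-congˡ (trans (GrowN.block-expand S b _) (1x-0y≈x _ _))) ⟩
    p ⊛ (⊖ closing X₀ Xs (hdom (λ _ → b 1))) ⊕ q ⊛ closing X₀ Xs (hdom (λ _ → b 0))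
      ≈⟨ +-cong (*-congˡ (-‿cong (GrowN.domino-linear S _))) (*-congˡ (GrowN.domino-linear S _)) ⟩
    p ⊛ (⊖ (b 1 0 ⊛ u ⊕ b 1 1 ⊛ v)) ⊕ q ⊛ (b 0 0 ⊛ u ⊕ b 0 1 ⊛ v)
      ≈⟨ solve 8 (λ p q a b c d u v → p :* (:- (c :* u :+ d :* v)) :+ q :* (a :* u :+ b :* v)
                                      := (q :* a :- p :* c) :* u :+ (q :* b :- p :* d) :* v)
               refl p q (b 0 0) (b 0 1) (b 1 0) (b 1 1) u v ⟩
    (q ⊛ b 0 0 ⊝ p ⊛ b 1 0) ⊛ u ⊕ (q ⊛ b 0 1 ⊝ p ⊛ b 1 1) ⊛ v ∎
    where
    u = closing X₀ Xs (hdom (unit N 0))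
    v = closing X₀ Xs (hdom (unit N 1))
  prefixVector-block {E} {X₀} {Xs} S b (p , q) = begin
    p ⊛ closing X₀ (Xs ++ block b ∷ []) (hdom (unit N 0)) ⊕ q ⊛ closing X₀ (Xs ++ block b ∷ []) (hdom (unit N 1))
      ≈⟨ +-cong (*-congˡ (trans (GrowE.block-expand S b _) (1x-0y≈x _ _)))
                (*-congˡ (trans (GrowE.block-expand S b _) (0x-1y≈-y _ _))) ⟩
    p ⊛ closing X₀ Xs (vdom (λ i _ → b i 1)) ⊕ q ⊛ (⊖ closing X₀ Xs (vdom (λ i _ → b i 0)))
      ≈⟨ +-cong (*-congˡ (GrowE.domino-linear S _)) (*-congˡ (-‿cong (GrowE.domino-linear S _))) ⟩
    p ⊛ (b 0 1 ⊛ u ⊕ b 1 1 ⊛ v) ⊕ q ⊛ (⊖ (b 0 0 ⊛ u ⊕ b 1 0 ⊛ v))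
      ≈⟨ solve 8 (λ p q a b c d u v → p :* (b :* u :+ d :* v) :+ q :* (:- (a :* u :+ c :* v))
                                      := (p :* b :- q :* a) :* u :+ (p :* d :- q :* c) :* v)
               refl p q (b 0 0) (b 0 1) (b 1 0) (b 1 1) u v ⟩
    (p ⊛ b 0 1 ⊝ q ⊛ b 0 0) ⊛ u ⊕ (p ⊛ b 1 1 ⊝ q ⊛ b 1 0) ⊛ v ∎
    where
    u = closing X₀ Xs (vdom (unit E 0))
    v = closing X₀ Xs (vdom (unit E 1))

  transfer : ∀ {d X₀ Xs k} → IsStaircase d X₀ Xs k → ∀ bs {e} → turnEach d bs ≡ e → ∀ f →
    signedDetOf (X₀ ∷ (Xs ++ (map block bs ++ domino e f ∷ []))) ≈ dot (throughBlocks d bs (coords e f)) (prefixVector d X₀ Xs)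
  transfer S []       ≡.refl f = domino-linear S f
  transfer {d} {X₀} {Xs} S (b ∷ bs) ≡.refl f = begin
    signedDetOf (X₀ ∷ (Xs ++ (block b ∷ map block bs ++ domino e f ∷ [])))
      ≡⟨ ≡.cong (λ L → signedDetOf (X₀ ∷ L)) (List.++-assoc Xs (block b ∷ []) _) ⟨
    signedDetOf (X₀ ∷ ((Xs ++ block b ∷ []) ++ (map block bs ++ domino e f ∷ [])))
      ≈⟨ transfer (block-shape S b) bs ≡.refl f ⟩
    dot (throughBlocks (turn d) bs (coords e f)) (prefixVector (turn d) X₀ (Xs ++ block b ∷ []))
      ≈⟨ prefixVector-block S b _ ⟩
    dot (throughBlocks d (b ∷ bs) (coords e f)) (prefixVector d X₀ Xs) ∎
    where e = turnEach (turn d) bs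

  blocks-shape : ∀ {d X₀ Xs k} → IsStaircase d X₀ Xs k →
    ∀ bs → IsStaircase (turnEach d bs) X₀ (Xs ++ map block bs) (length bs + k)
  blocks-shape {d} {X₀} {Xs} {k} S [] = ≡.subst (λ L → IsStaircase d X₀ L k) (≡.sym (List.++-identityʳ Xs)) S
  blocks-shape {d} {X₀} {Xs} {k} S (b ∷ bs) =
    ≡.subst₂ (IsStaircase (turnEach (turn d) bs) X₀)
             (List.++-assoc Xs (block b ∷ []) (map block bs)) (ℕ.+-suc (length bs) k)
             (blocks-shape (block-shape S b) bs)

module Factorisation {c ℓ} (R : CommutativeRing c ℓ) (x : ℕ → ℕ → CommutativeRing.Carrier R) (w : List Dir) where
  open CommutativeRing R renaming (_+_ to _⊕_; _*_ to _⊛_; -_ to ⊖_; _-_ to _⊝_)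
  open WithRing R
  open Determinant R
  open Layout R
  open Transfer R

  firstEntries lastEntries : Dir → ℕ × ℕ → Matrix
  firstEntries N p _ j = blockEnt x p 1 j
  firstEntries E p i _ = blockEnt x p i 0
  lastEntries  N p _ j = blockEnt x p 0 j
  lastEntries  E p i _ = blockEnt x p i 1

  first : ℕ → Piece
  first r = domino (wAt w r) (firstEntries (wAt w r) (P w r))

  blockAt : ℕ → Matrix
  blockAt k = blockEnt x (P w k)

  bendBlocks : ℕ → ℕ → List Matrix
  bendBlocks r s = map blockAt (bends w r s)

  mapB-≡ : ∀ ks → mapB x w ks ≡ map block (map blockAt ks)
  mapB-≡ []       = ≡.refl
  mapB-≡ (k ∷ ks) = ≡.cong (B x (P w k) ∷_) (mapB-≡ ks)

  stdPieces-shape : ∀ r s → stdPieces x w r s ≡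
    first r ∷ (map block (bendBlocks r s) ++ domino (wAt w s) (lastEntries (wAt w s) (P w (suc s))) ∷ [])
  stdPieces-shape r s with wAt w r | wAt w s | mapB-≡ (bends w r s)
  ... | N | N | eq = ≡.cong (λ L → _ ∷ (L ++ _)) eq
  ... | N | E | eq = ≡.cong (λ L → _ ∷ (L ++ _)) eq
  ... | E | N | eq = ≡.cong (λ L → _ ∷ (L ++ _)) eq
  ... | E | E | eq = ≡.cong (λ L → _ ∷ (L ++ _)) eq

  first-shape : ∀ r → IsStaircase (wAt w r) (first r) [] 0
  first-shape r with wAt w r
  ... | N = record { slot-≡ = ≡.refl ; height-≡ = ≡.refl ; width-≡ = ≡.refl }
  ... | E = record { slot-≡ = ≡.refl ; height-≡ = ≡.refl ; width-≡ = ≡.refl }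

  prefix : ℕ → ℕ → Carrier × Carrier
  prefix r t = prefixVector (wAt w t) (first r) (map block (bendBlocks r t))

  suffix : ℕ → ℕ → Carrier × Carrier
  suffix t s = throughBlocks (wAt w t) (bendBlocks t s) (coords (wAt w s) (lastEntries (wAt w s) (P w (suc s))))

  turnEach-bendBlocks : ∀ {r s} → r ≤ s → turnEach (wAt w r) (bendBlocks r s) ≡ wAt w s
  turnEach-bendBlocks {r} {s} r≤s =
    ≡.trans (turnEach-map (wAt w r) _ (bends w r s)) (turnEach-bends w (ℕ.≤⇒≤′ r≤s))

  blocks-++ : ∀ {r t s} → r ≤ t → t ≤ s → ∀ Ys →
    map block (bendBlocks r s) ++ Ys ≡ map block (bendBlocks r t) ++ (map block (bendBlocks t s) ++ Ys)
  blocks-++ {r} {t} {s} r≤t t≤s Ys = begin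
    map block (bendBlocks r s) ++ Ys
      ≡⟨ ≡.cong (λ ks → map block (map blockAt ks) ++ Ys) (bends-++ w r≤t t≤s) ⟩
    map block (map blockAt (bends w r t ++ bends w t s)) ++ Ys
      ≡⟨ ≡.cong (λ L → map block L ++ Ys) (List.map-++ blockAt (bends w r t) (bends w t s)) ⟩
    map block (bendBlocks r t ++ bendBlocks t s) ++ Ys
      ≡⟨ ≡.cong (_++ Ys) (List.map-++ block (bendBlocks r t) (bendBlocks t s)) ⟩
    (map block (bendBlocks r t) ++ map block (bendBlocks t s)) ++ Ys
      ≡⟨ List.++-assoc (map block (bendBlocks r t)) (map block (bendBlocks t s)) Ys ⟩
    map block (bendBlocks r t) ++ (map block (bendBlocks t s) ++ Ys) ∎
    where open ≡.≡-Reasoning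

  c-factorises : ∀ {r t s} → r ≤ t → t ≤ s → cc x w r s ≈ dot (suffix t s) (prefix r t)
  c-factorises {r} {t} {s} r≤t t≤s = begin
    signedDetOf (stdPieces x w r s)
      ≡⟨ ≡.cong signedDetOf (stdPieces-shape r s) ⟩
    signedDetOf (first r ∷ (map block (bendBlocks r s) ++ final))
      ≡⟨ ≡.cong (λ L → signedDetOf (first r ∷ L)) (blocks-++ r≤t t≤s final) ⟩
    signedDetOf (first r ∷ (map block (bendBlocks r t) ++ (map block (bendBlocks t s) ++ final)))
      ≈⟨ transfer prefix-shape (bendBlocks t s) (turnEach-bendBlocks t≤s) f ⟩
    dot (suffix t s) (prefix r t) ∎
    where
    open SetoidReasoning setoid
    f = lastEntries (wAt w s) (P w (suc s))
    final = domino (wAt w s) f ∷ []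

    prefix-shape : IsStaircase (wAt w t) (first r) (map block (bendBlocks r t)) (length (bendBlocks r t) + 0)
    prefix-shape = ≡.subst (λ d → IsStaircase d (first r) (map block (bendBlocks r t)) (length (bendBlocks r t) + 0))
                           (turnEach-bendBlocks r≤t) (blocks-shape (first-shape r) (bendBlocks r t))

  det₃-c≈0 : ∀ (r s : ℕ → ℕ) → (∀ i j → i < 3 → j < 3 → r i ≤ s j) →
             det 3 (λ i j → cc x w (r i) (s j)) ≈ 0#
  det₃-c≈0 r s r≤s = begin
    det 3 (λ i j → cc x w (r i) (s j))
      ≈⟨ det-cong 3 (λ i j i<3 j<3 → c-factorises (r≤t i i<3) (t≤s j j<3)) ⟩
    det 3 (λ i j → dot (suffix t (s j)) (prefix (r i) t))
      ≈⟨ det₃-rank₂ (λ i → proj₁ (prefix (r i) t)) (λ i → proj₂ (prefix (r i) t))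
                    (λ j → proj₁ (suffix t (s j))) (λ j → proj₂ (suffix t (s j))) ⟩
    0# ∎
    where
    open SetoidReasoning setoid
    t = r 0 ⊔ (r 1 ⊔ r 2)
    r≤t : ∀ i → i < 3 → r i ≤ t
    r≤t 0 _ = ℕ.m≤m⊔n (r 0) _
    r≤t 1 _ = ℕ.≤-trans (ℕ.m≤m⊔n (r 1) (r 2)) (ℕ.m≤n⊔m (r 0) _)
    r≤t 2 _ = ℕ.≤-trans (ℕ.m≤n⊔m (r 1) (r 2)) (ℕ.m≤n⊔m (r 0) _)
    r≤t (suc (suc (suc _))) (s≤s (s≤s (s≤s ())))
    t≤s : ∀ j → j < 3 → t ≤ s j
    t≤s j j<3 = ℕ.⊔-lub (r≤s 0 j (s≤s z≤n) j<3) (ℕ.⊔-lub (r≤s 1 j (s≤s (s≤s z≤n)) j<3) (r≤s 2 j ℕ.≤-refl j<3))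

corollary8p4 : ∀ {c ℓ} (R : CommutativeRing c ℓ) (x : ℕ → ℕ → CommutativeRing.Carrier R)
    (w : List Dir) (a b : ℕ) →
    1 ≤ a → a ≤ length w ∸ 2 → 1 ≤ b → b ≤ length w ∸ 2 →
    (∀ a′ b′ → a ≤ a′ → a′ ≤ a + 2 → b ≤ b′ → b′ ≤ b + 2 →
      nth (ρ w) a′ ≤ nth (κ w) b′) →
    CommutativeRing._≈_ R
      (WithRing.det R 3
        (λ i j → WithRing.cc R x w (nth (ρ w) (a + 2 ∸ i)) (nth (κ w) (b + j))))
      (CommutativeRing.0# R)
corollary8p4 R x w a b _ _ _ _ ρ≤κ =
  Factorisation.det₃-c≈0 R x w (λ i → nth (ρ w) (a + 2 ∸ i)) (λ j → nth (κ w) (b + j))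
    λ i j i<3 j<3 → ρ≤κ _ _ (a≤a+2∸i i<3) (ℕ.m∸n≤m (a + 2) i) (ℕ.m≤m+n b j) (ℕ.+-monoʳ-≤ b (ℕ.≤-pred j<3))
  where
  a≤a+2∸i : ∀ {i} → i < 3 → a ≤ a + 2 ∸ i
  a≤a+2∸i {i} i<3 = ≡.subst (a ≤_) (≡.sym (ℕ.+-∸-assoc a (ℕ.≤-pred i<3))) (ℕ.m≤m+n a (2 ∸ i))
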